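{- Let $Q(t,x,y)=\sum_G t^{\mathrm{uhu}(G)}x^{\#H(G)}y^{\#U(G)}$, the sum over all bargraphs $G$. Then $$xQ^2-(1-x-y-txy)Q+xy=0.$$
   Context: A bargraph is a lattice path with steps $U=(0,1)$, $H=(1,0)$, $D=(0,-1)$, identified with its word over $\{U,H,D\}$, that starts at the origin, ends on the $x$-axis, stays strictly above the $x$-axis except at its endpoints, and contains no two consecutive steps $UD$ or $DU$ (the empty path is not a bargraph). $\#H(G)$, $\#U(G)$ denote the numbers of $H$ and $U$ steps, and $\mathrm{uhu}(G)$ is the number of occurrences of the consecutive factor $UHU$ in $G$. -}

module Defs where

open import Data.Bool using (Bool; true; false; _∧_; not)
open import Data.Nat using (ℕ; zero; suc; _∸_; _≡ᵇ_)
import Data.Nat as ℕ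
open import Data.Integer using (ℤ; +_; _+_; _-_; _*_)
open import Data.List using (List; []; _∷_; length; concatMap; filterᵇ)

data Step : Set where
  U H D : Step      -- U = (0,1), H = (1,0), D = (0,-1)

allWords : ℕ → List (List Step)
allWords zero    = [] ∷ []
allWords (suc L) = concatMap (λ w → (U ∷ w) ∷ (H ∷ w) ∷ (D ∷ w) ∷ []) (allWords L)

-- The geometric condition, read on the path as a curve:
-- starts at the origin, ends on the x-axis, and every point of the path
-- other than the two endpoints lies strictly above the x-axis.
-- `inner h w` : we are at a point of height h reached by at least one step;
-- the remaining steps are w.
inner : ℕ → List Step → Bool
inner zero    []      = true
inner zero    (_ ∷ _) = false
inner (suc h) []      = false
inner (suc h) (U ∷ w) = inner (suc (suc h)) w
inner (suc h) (H ∷ w) = inner (suc h) w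
inner (suc h) (D ∷ w) = inner h w

-- From the origin: the path is nonempty, and its first step must leave the
-- axis upwards (an H step from height 0 runs along the axis, a D step goes
-- below it).
aboveAxis : List Step → Bool
aboveAxis []      = false
aboveAxis (U ∷ w) = inner 1 w
aboveAxis (H ∷ w) = false
aboveAxis (D ∷ w) = false

noUDDU : List Step → Bool
noUDDU (U ∷ D ∷ w) = false
noUDDU (D ∷ U ∷ w) = false
noUDDU (_ ∷ w)     = noUDDU w
noUDDU []          = true

isBargraph : List Step → Bool
isBargraph w = aboveAxis w ∧ noUDDU w

#H : List Step → ℕ
#H []      = 0
#H (H ∷ w) = suc (#H w)
#H (_ ∷ w) = #H w

#U : List Step → ℕ
#U []      = 0
#U (U ∷ w) = suc (#U w)
#U (_ ∷ w) = #U w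

uhu : List Step → ℕ
uhu (U ∷ H ∷ U ∷ w) = suc (uhu (H ∷ U ∷ w))
uhu (_ ∷ w)         = uhu w
uhu []              = 0

-- Formal power series in t, x, y with integer coefficients,
-- represented by their coefficient function: f k n m = [t^k x^n y^m] f.

FPS : Set
FPS = ℕ → ℕ → ℕ → ℤ

sumTo : ℕ → (ℕ → ℤ) → ℤ
sumTo zero    f = f 0
sumTo (suc k) f = sumTo k f + f (suc k)

_⊕_ : FPS → FPS → FPS
(f ⊕ g) k n m = f k n m + g k n m

_⊖_ : FPS → FPS → FPS
(f ⊖ g) k n m = f k n m - g k n m

_⊛_ : FPS → FPS → FPS
(f ⊛ g) k n m =
  sumTo k λ i → sumTo n λ j → sumTo m λ l →
    f i j l * g (k ∸ i) (n ∸ j) (m ∸ l)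

infixl 6 _⊕_ _⊖_
infixl 7 _⊛_

mono : ℕ → ℕ → ℕ → FPS
mono a b c k n m with (a ≡ᵇ k) ∧ (b ≡ᵇ n) ∧ (c ≡ᵇ m)
... | true  = + 1
... | false = + 0

𝟙 𝕥 𝕩 𝕪 : FPS
𝟙 = mono 0 0 0
𝕥 = mono 1 0 0
𝕩 = mono 0 1 0
𝕪 = mono 0 0 1

-- A bargraph with #H = n and #U = m has #D = m (it ends at height 0),
-- hence has length n + 2m; so its coefficient is the number of bargraphs
-- among the words of that length with the given statistics.

countBargraphs : ℕ → ℕ → ℕ → ℕ
countBargraphs k n m =
  length (filterᵇ (λ w → isBargraph w ∧ (uhu w ≡ᵇ k) ∧ (#H w ≡ᵇ n) ∧ (#U w ≡ᵇ m))
                  (allWords (n ℕ.+ (m ℕ.+ m))))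

Q : FPS
Q k n m = + countBargraphs k n m

-- Every bargraph is U b D, where the body b walks from height 1 back to height 1 without
-- touching the axis.  Looking at how b ends sorts bargraphs into five disjoint families:
-- UHD; U G D; G with one more H before its final D; U H G D; and U a H G′ D, where
-- G = U a D and G′ is the last excursion of b above height 1.  Here G and G′ range over
-- all bargraphs, and each bargraph arises exactly once.  Only U H G D creates a new factor
-- UHU, so Q = xy + yQ + xQ + txyQ + xQ², which is the claimed equation rearranged.
-- Coefficientwise, the number of bargraphs with given statistics is a sum over all words
-- of length n + 2m, and the decomposition splits that sum into the five terms; the
-- product xQ² appears by splitting both the length and the statistics between G and G′.

module Submission where

open import Defs
open import Data.Bool using (Bool; true; false; _∧_; not; T)
open import Data.Bool.Properties using (T-∧; ∧-assoc)
open import Data.Nat as ℕ using (ℕ; zero; suc; _∸_; _≡ᵇ_; _≤ᵇ_; _<ᵇ_; z≤n)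
import Data.Nat.Properties as ℕ
import Data.Nat.Tactic.RingSolver as ℕ-Solver
open import Data.Integer using (ℤ; +_; 0ℤ; _+_; _-_; _*_)
import Data.Integer.Properties as ℤ
open import Data.Integer.Tactic.RingSolver using (solve-∀)
open import Data.List using (List; []; _∷_; length; concatMap; filterᵇ; foldr; _++_; _∷ʳ_; initLast; _∷ʳ′_)
import Data.List.Properties as List
open import Data.Maybe using (Maybe; just; nothing)
open import Data.Product using (∃; ∃₂; _×_; _,_; proj₁; proj₂)
open import Data.Sum using (_⊎_; inj₁; inj₂)
open import Data.Empty using (⊥; ⊥-elim)
open import Function using (_∘_; _$_)
open import Function.Bundles using (Equivalence)
open import Relation.Nullary using (¬_; does; yes; no)
open import Relation.Nullary.Decidable using (T?; dec-true; dec-false)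
open import Relation.Binary.Definitions using (DecidableEquality)
open import Relation.Binary.PropositionalEquality

𝕀 : Bool → ℤ
𝕀 true  = + 1
𝕀 false = 0ℤ

𝕀-∧ : ∀ a b → 𝕀 (a ∧ b) ≡ 𝕀 a * 𝕀 b
𝕀-∧ true  b = sym (ℤ.*-identityˡ (𝕀 b))
𝕀-∧ false b = refl

𝕀-∧³ : ∀ p q r → 𝕀 (p ∧ q ∧ r) ≡ 𝕀 p * (𝕀 q * 𝕀 r)
𝕀-∧³ p q r = trans (𝕀-∧ p (q ∧ r)) (cong (𝕀 p *_) (𝕀-∧ q r))

𝕀-true : ∀ {b} → T b → 𝕀 b ≡ + 1
𝕀-true {true} _ = refl

𝕀-false : ∀ {b} → ¬ T b → 𝕀 b ≡ 0ℤ
𝕀-false {false} _  = refl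
𝕀-false {true}  ¬b = ⊥-elim (¬b _)

𝕀-*-cong : ∀ b {x y} → (T b → x ≡ y) → 𝕀 b * x ≡ 𝕀 b * y
𝕀-*-cong true  x≡y = cong (+ 1 *_) (x≡y _)
𝕀-*-cong false {x} {y} _ = trans (ℤ.*-zeroˡ x) (sym (ℤ.*-zeroˡ y))

𝕀-*-zero : ∀ b {x} → (T b → x ≡ 0ℤ) → 𝕀 b * x ≡ 0ℤ
𝕀-*-zero b x≡0 = trans (𝕀-*-cong b x≡0) (ℤ.*-zeroʳ (𝕀 b))

𝕀-≡ᵇ-* : ∀ {m n} (y : ℤ) → m ≡ n → 𝕀 (m ≡ᵇ n) * y ≡ y
𝕀-≡ᵇ-* {m} {n} y m≡n = trans (cong (_* y) (𝕀-true (ℕ.≡⇒≡ᵇ m n m≡n))) (ℤ.*-identityˡ y)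

+-cong₅ : ∀ {a b c d e a′ b′ c′ d′ e′ : ℤ} → a ≡ a′ → b ≡ b′ → c ≡ c′ → d ≡ d′ → e ≡ e′ →
             a + b + c + d + e ≡ a′ + b′ + c′ + d′ + e′
+-cong₅ refl refl refl refl refl = refl

𝕀-interchange³ : ∀ p x q y r z → 𝕀 p * 𝕀 x * (𝕀 q * 𝕀 y * (𝕀 r * 𝕀 z)) ≡ 𝕀 (p ∧ q ∧ r) * 𝕀 (x ∧ y ∧ z)
𝕀-interchange³ p x q y r z = begin
  𝕀 p * 𝕀 x * (𝕀 q * 𝕀 y * (𝕀 r * 𝕀 z))    ≡⟨ interchange (𝕀 p) (𝕀 x) (𝕀 q) (𝕀 y) (𝕀 r) (𝕀 z) ⟩
  𝕀 p * (𝕀 q * 𝕀 r) * (𝕀 x * (𝕀 y * 𝕀 z))  ≡⟨ cong₂ _*_ (𝕀-∧³ p q r) (𝕀-∧³ x y z) ⟨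
  𝕀 (p ∧ q ∧ r) * 𝕀 (x ∧ y ∧ z)              ∎
  where
  open ≡-Reasoning
  interchange : ∀ p x q y r z → p * x * (q * y * (r * z)) ≡ p * (q * r) * (x * (y * z))
  interchange = solve-∀

𝕀-∧-interchange³ : ∀ p x q y r z → 𝕀 ((p ∧ x) ∧ (q ∧ y) ∧ (r ∧ z)) ≡ 𝕀 (p ∧ q ∧ r) * 𝕀 (x ∧ y ∧ z)
𝕀-∧-interchange³ p x q y r z =
  trans (𝕀-∧³ (p ∧ x) (q ∧ y) (r ∧ z))
        (trans (cong₂ _*_ (𝕀-∧ p x) (cong₂ _*_ (𝕀-∧ q y) (𝕀-∧ r z))) (𝕀-interchange³ p x q y r z))

sumTo-cong : ∀ k {f g : ℕ → ℤ} → (∀ i → i ℕ.≤ k → f i ≡ g i) → sumTo k f ≡ sumTo k g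
sumTo-cong zero    f≗g = f≗g 0 z≤n
sumTo-cong (suc k) f≗g =
  cong₂ _+_ (sumTo-cong k (λ i i≤k → f≗g i (ℕ.m≤n⇒m≤1+n i≤k))) (f≗g (suc k) ℕ.≤-refl)

sumTo-zero : ∀ k → sumTo k (λ _ → 0ℤ) ≡ 0ℤ
sumTo-zero zero    = refl
sumTo-zero (suc k) rewrite sumTo-zero k = refl

sumTo-+ : ∀ k (f g : ℕ → ℤ) → sumTo k (λ i → f i + g i) ≡ sumTo k f + sumTo k g
sumTo-+ zero    f g = refl
sumTo-+ (suc k) f g = trans (cong (_+ (f (suc k) + g (suc k))) (sumTo-+ k f g))
                            (regroup (sumTo k f) (sumTo k g) (f (suc k)) (g (suc k)))
  where
  regroup : ∀ a b c d → a + b + (c + d) ≡ a + c + (b + d)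
  regroup = solve-∀

sumTo-- : ∀ k (f g : ℕ → ℤ) → sumTo k (λ i → f i - g i) ≡ sumTo k f - sumTo k g
sumTo-- zero    f g = refl
sumTo-- (suc k) f g = trans (cong (_+ (f (suc k) - g (suc k))) (sumTo-- k f g))
                            (regroup (sumTo k f) (sumTo k g) (f (suc k)) (g (suc k)))
  where
  regroup : ∀ a b c d → a - b + (c - d) ≡ a + c - (b + d)
  regroup = solve-∀

sumTo-*ˡ : ∀ k c (f : ℕ → ℤ) → sumTo k (λ i → c * f i) ≡ c * sumTo k f
sumTo-*ˡ zero    c f = refl
sumTo-*ˡ (suc k) c f =
  trans (cong (_+ c * f (suc k)) (sumTo-*ˡ k c f)) (sym (ℤ.*-distribˡ-+ c (sumTo k f) (f (suc k))))

sumTo-*ʳ : ∀ N c (g : ℕ → ℤ) → sumTo N (λ i → g i * c) ≡ sumTo N g * c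
sumTo-*ʳ N c g = begin
  sumTo N (λ i → g i * c)    ≡⟨ sumTo-cong N (λ i _ → ℤ.*-comm (g i) c) ⟩
  sumTo N (λ i → c * g i)    ≡⟨ sumTo-*ˡ N c g ⟩
  c * sumTo N g              ≡⟨ ℤ.*-comm c (sumTo N g) ⟩
  sumTo N g * c              ∎
  where open ≡-Reasoning

sumTo-suc : ∀ k (f : ℕ → ℤ) → sumTo (suc k) f ≡ f 0 + sumTo k (λ i → f (suc i))
sumTo-suc zero    f = refl
sumTo-suc (suc k) f =
  trans (cong (_+ f (suc (suc k))) (sumTo-suc k f)) (ℤ.+-assoc (f 0) _ _)

sumTo-indicator : ∀ a k (g : ℕ → ℤ) → sumTo k (λ i → 𝕀 (a ≡ᵇ i) * g i) ≡ 𝕀 (a ≤ᵇ k) * g a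
sumTo-indicator zero    zero    g = refl
sumTo-indicator (suc a) zero    g = refl
sumTo-indicator zero    (suc k) g = begin
  sumTo (suc k) (λ i → 𝕀 (0 ≡ᵇ i) * g i)  ≡⟨ sumTo-suc k _ ⟩
  + 1 * g 0 + sumTo k (λ _ → 0ℤ)          ≡⟨ cong (_+_ (+ 1 * g 0)) (sumTo-zero k) ⟩
  + 1 * g 0 + 0ℤ                          ≡⟨ ℤ.+-identityʳ _ ⟩
  + 1 * g 0                               ∎
  where open ≡-Reasoning
sumTo-indicator (suc a) (suc k) g = begin
  sumTo (suc k) (λ i → 𝕀 (suc a ≡ᵇ i) * g i)              ≡⟨ sumTo-suc k _ ⟩
  0ℤ + sumTo k (λ i → 𝕀 (a ≡ᵇ i) * g (suc i))             ≡⟨ ℤ.+-identityˡ _ ⟩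
  sumTo k (λ i → 𝕀 (a ≡ᵇ i) * g (suc i))                  ≡⟨ sumTo-indicator a k (λ i → g (suc i)) ⟩
  𝕀 (a ≤ᵇ k) * g (suc a)                                  ≡⟨ cong (λ b → 𝕀 b * g (suc a)) (≤ᵇ-suc a k) ⟩
  𝕀 (suc a ≤ᵇ suc k) * g (suc a)                          ∎
  where
  open ≡-Reasoning
  ≤ᵇ-suc : ∀ a k → (a ≤ᵇ k) ≡ (suc a ≤ᵇ suc k)
  ≤ᵇ-suc zero    k = refl
  ≤ᵇ-suc (suc a) k = refl

sumTo-comm : ∀ N k (F : ℕ → ℕ → ℤ) → sumTo N (λ t → sumTo k (F t)) ≡ sumTo k (λ i → sumTo N (λ t → F t i))
sumTo-comm zero    k F = refl
sumTo-comm (suc N) k F =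
  trans (cong (_+ sumTo k (F (suc N))) (sumTo-comm N k F)) (sym (sumTo-+ k _ (F (suc N))))

+-≡ᵇ : ∀ a b K → (a ℕ.+ b ≡ᵇ K) ≡ (a ≤ᵇ K) ∧ (b ≡ᵇ K ∸ a)
+-≡ᵇ zero    b K       = refl
+-≡ᵇ (suc a) b zero    = refl
+-≡ᵇ (suc a) b (suc K) = trans (+-≡ᵇ a b K) (cong (_∧ (b ≡ᵇ K ∸ a)) (<ᵇ-suc a K))
  where
  <ᵇ-suc : ∀ a K → (a ≤ᵇ K) ≡ (a <ᵇ suc K)
  <ᵇ-suc zero    K = refl
  <ᵇ-suc (suc a) K = refl

𝕀-+-≡ᵇ : ∀ a b K → 𝕀 (a ℕ.+ b ≡ᵇ K) ≡ sumTo K (λ i → 𝕀 (a ≡ᵇ i) * 𝕀 (b ≡ᵇ K ∸ i))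
𝕀-+-≡ᵇ a b K = begin
  𝕀 (a ℕ.+ b ≡ᵇ K)                             ≡⟨ cong 𝕀 (+-≡ᵇ a b K) ⟩
  𝕀 ((a ≤ᵇ K) ∧ (b ≡ᵇ K ∸ a))                  ≡⟨ 𝕀-∧ (a ≤ᵇ K) _ ⟩
  𝕀 (a ≤ᵇ K) * 𝕀 (b ≡ᵇ K ∸ a)                  ≡⟨ sumTo-indicator a K (λ i → 𝕀 (b ≡ᵇ K ∸ i)) ⟨
  sumTo K (λ i → 𝕀 (a ≡ᵇ i) * 𝕀 (b ≡ᵇ K ∸ i))  ∎
  where open ≡-Reasoning

sum³ : ℕ → ℕ → ℕ → (ℕ → ℕ → ℕ → ℤ) → ℤ
sum³ k n m F = sumTo k λ i → sumTo n λ j → sumTo m λ l → F i j l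

sum³-cong : ∀ k n m {F G : ℕ → ℕ → ℕ → ℤ} →
  (∀ i j l → i ℕ.≤ k → j ℕ.≤ n → l ℕ.≤ m → F i j l ≡ G i j l) → sum³ k n m F ≡ sum³ k n m G
sum³-cong k n m F≗G =
  sumTo-cong k λ i i≤k → sumTo-cong n λ j j≤n → sumTo-cong m λ l l≤m → F≗G i j l i≤k j≤n l≤m

sum³-*ˡ : ∀ k n m c (F : ℕ → ℕ → ℕ → ℤ) → sum³ k n m (λ i j l → c * F i j l) ≡ c * sum³ k n m F
sum³-*ˡ k n m c F =
  trans (sumTo-cong k λ i _ → trans (sumTo-cong n λ j _ → sumTo-*ˡ m c (F i j))
                                    (sumTo-*ˡ n c (λ j → sumTo m (F i j))))
        (sumTo-*ˡ k c _)

sumTo-sum³ : ∀ N k n m (F : ℕ → ℕ → ℕ → ℕ → ℤ) →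
  sumTo N (λ t → sum³ k n m (F t)) ≡ sum³ k n m (λ i j l → sumTo N (λ t → F t i j l))
sumTo-sum³ N k n m F =
  trans (sumTo-comm N k _) (sumTo-cong k λ i _ →
  trans (sumTo-comm N n _) (sumTo-cong n λ j _ → sumTo-comm N m _))

infixl 6 _+³_ _∸³_
infix 4 _≡ᵇ³_ _≤ᵇ³_

_+³_ : ℕ × ℕ × ℕ → ℕ × ℕ × ℕ → ℕ × ℕ × ℕ
(a , b , c) +³ (x , y , z) = a ℕ.+ x , b ℕ.+ y , c ℕ.+ z

+³-identityʳ : ∀ s → s +³ (0 , 0 , 0) ≡ s
+³-identityʳ (a , b , c) =
  cong₂ _,_ (ℕ.+-identityʳ a) (cong₂ _,_ (ℕ.+-identityʳ b) (ℕ.+-identityʳ c))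

_∸³_ : ℕ × ℕ × ℕ → ℕ × ℕ × ℕ → ℕ × ℕ × ℕ
(k , n , m) ∸³ (a , b , c) = k ∸ a , n ∸ b , m ∸ c

_≡ᵇ³_ : ℕ × ℕ × ℕ → ℕ × ℕ × ℕ → Bool
(a , b , c) ≡ᵇ³ (k , n , m) = (a ≡ᵇ k) ∧ (b ≡ᵇ n) ∧ (c ≡ᵇ m)

_≤ᵇ³_ : ℕ × ℕ × ℕ → ℕ × ℕ × ℕ → Bool
(a , b , c) ≤ᵇ³ (k , n , m) = (a ≤ᵇ k) ∧ (b ≤ᵇ n) ∧ (c ≤ᵇ m)

≡ᵇ³⇒≡ : ∀ s t → T (s ≡ᵇ³ t) → s ≡ t
≡ᵇ³⇒≡ (a , b , c) (k , n , m) eq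
  with ea , ebc ← Equivalence.to (T-∧ {a ≡ᵇ k}) eq
  with eb , ec ← Equivalence.to (T-∧ {b ≡ᵇ n}) ebc
  rewrite ℕ.≡ᵇ⇒≡ a k ea | ℕ.≡ᵇ⇒≡ b n eb | ℕ.≡ᵇ⇒≡ c m ec = refl

≤ᵇ³⇒≤ : ∀ a b c k n m → T ((a , b , c) ≤ᵇ³ (k , n , m)) → a ℕ.≤ k × b ℕ.≤ n × c ℕ.≤ m
≤ᵇ³⇒≤ a b c k n m le
  with a≤k , rest ← Equivalence.to (T-∧ {a ≤ᵇ k}) le
  with b≤n , c≤m ← Equivalence.to (T-∧ {b ≤ᵇ n}) rest
  = ℕ.≤ᵇ⇒≤ a k a≤k , ℕ.≤ᵇ⇒≤ b n b≤n , ℕ.≤ᵇ⇒≤ c m c≤m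

𝕀-+³-≡ᵇ³ : ∀ s t K → 𝕀 (s +³ t ≡ᵇ³ K) ≡ 𝕀 (s ≤ᵇ³ K) * 𝕀 (t ≡ᵇ³ K ∸³ s)
𝕀-+³-≡ᵇ³ (a , b , c) (x , y , z) (k , n , m) =
  trans (cong₂ (λ p q → 𝕀 (p ∧ q)) (+-≡ᵇ a x k) (cong₂ _∧_ (+-≡ᵇ b y n) (+-≡ᵇ c z m)))
        (𝕀-∧-interchange³ (a ≤ᵇ k) (x ≡ᵇ k ∸ a) (b ≤ᵇ n) (y ≡ᵇ n ∸ b) (c ≤ᵇ m) (z ≡ᵇ m ∸ c))

𝕀-+³-split : ∀ s t k n m →
  𝕀 (s +³ t ≡ᵇ³ (k , n , m)) ≡ sum³ k n m (λ i j l → 𝕀 (s ≡ᵇ³ (i , j , l)) * 𝕀 (t ≡ᵇ³ (k ∸ i , n ∸ j , m ∸ l)))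
𝕀-+³-split (a , b , c) (x , y , z) k n m = begin
  𝕀 ((a ℕ.+ x ≡ᵇ k) ∧ (b ℕ.+ y ≡ᵇ n) ∧ (c ℕ.+ z ≡ᵇ m))
    ≡⟨ 𝕀-∧³ (a ℕ.+ x ≡ᵇ k) (b ℕ.+ y ≡ᵇ n) (c ℕ.+ z ≡ᵇ m) ⟩
  𝕀 (a ℕ.+ x ≡ᵇ k) * (𝕀 (b ℕ.+ y ≡ᵇ n) * 𝕀 (c ℕ.+ z ≡ᵇ m))
    ≡⟨ cong₂ _*_ (𝕀-+-≡ᵇ a x k) (cong₂ _*_ (𝕀-+-≡ᵇ b y n) (𝕀-+-≡ᵇ c z m)) ⟩
  sumTo k A * (sumTo n B * sumTo m C)
    ≡⟨ sumTo-*ʳ k _ A ⟨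
  sumTo k (λ i → A i * (sumTo n B * sumTo m C))
    ≡⟨ sumTo-cong k (λ i _ → trans (cong (A i *_) (sym (sumTo-*ʳ n _ B))) (sym (sumTo-*ˡ n (A i) _))) ⟩
  sumTo k (λ i → sumTo n λ j → A i * (B j * sumTo m C))
    ≡⟨ sumTo-cong k (λ i _ → sumTo-cong n λ j _ →
         trans (cong (λ s → A i * s) (sym (sumTo-*ˡ m (B j) C))) (sym (sumTo-*ˡ m (A i) _))) ⟩
  sum³ k n m (λ i j l → A i * (B j * C l))
    ≡⟨ sum³-cong k n m (λ i j l _ _ _ →
         𝕀-interchange³ (a ≡ᵇ i) (x ≡ᵇ k ∸ i) (b ≡ᵇ j) (y ≡ᵇ n ∸ j) (c ≡ᵇ l) (z ≡ᵇ m ∸ l)) ⟩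
  sum³ k n m (λ i j l → 𝕀 ((a ≡ᵇ i) ∧ (b ≡ᵇ j) ∧ (c ≡ᵇ l)) * 𝕀 ((x ≡ᵇ k ∸ i) ∧ (y ≡ᵇ n ∸ j) ∧ (z ≡ᵇ m ∸ l))) ∎
  where
  open ≡-Reasoning
  A B C : ℕ → ℤ
  A i = 𝕀 (a ≡ᵇ i) * 𝕀 (x ≡ᵇ k ∸ i)
  B j = 𝕀 (b ≡ᵇ j) * 𝕀 (y ≡ᵇ n ∸ j)
  C l = 𝕀 (c ≡ᵇ l) * 𝕀 (z ≡ᵇ m ∸ l)

_≟ˢ_ : DecidableEquality Step
U ≟ˢ U = yes refl
U ≟ˢ H = no λ ()
U ≟ˢ D = no λ ()
H ≟ˢ U = no λ ()
H ≟ˢ H = yes refl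
H ≟ˢ D = no λ ()
D ≟ˢ U = no λ ()
D ≟ˢ H = no λ ()
D ≟ˢ D = yes refl

_≟ʷ_ : DecidableEquality (List Step)
_≟ʷ_ = List.≡-dec _≟ˢ_

δ : List Step → List Step → ℤ
δ u w = 𝕀 (does (u ≟ʷ w))

δ-refl : ∀ u → δ u u ≡ + 1
δ-refl u = cong 𝕀 (dec-true (u ≟ʷ u) refl)

δ-≢ : ∀ {u w} → u ≢ w → δ u w ≡ 0ℤ
δ-≢ {u} {w} u≢w = cong 𝕀 (dec-false (u ≟ʷ w) u≢w)

δ-∷ : ∀ x y u w → δ (x ∷ u) (y ∷ w) ≡ 𝕀 (does (x ≟ˢ y)) * δ u w
δ-∷ x y u w = 𝕀-∧ (does (x ≟ˢ y)) (does (u ≟ʷ w))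

sumWords : ℕ → (List Step → ℤ) → ℤ
sumWords zero    f = f []
sumWords (suc L) f =
  sumWords L (λ w → f (U ∷ w)) + sumWords L (λ w → f (H ∷ w)) + sumWords L (λ w → f (D ∷ w))

sumWords-cong : ∀ L {f g : List Step → ℤ} → (∀ w → length w ≡ L → f w ≡ g w) →
                sumWords L f ≡ sumWords L g
sumWords-cong zero    f≗g = f≗g [] refl
sumWords-cong (suc L) f≗g =
  cong₂ _+_ (cong₂ _+_ (sumWords-cong L (λ w eq → f≗g _ (cong suc eq)))
                       (sumWords-cong L (λ w eq → f≗g _ (cong suc eq))))
            (sumWords-cong L (λ w eq → f≗g _ (cong suc eq)))

sumWords-zero : ∀ L → sumWords L (λ _ → 0ℤ) ≡ 0ℤ
sumWords-zero zero    = refl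
sumWords-zero (suc L) rewrite sumWords-zero L = refl

sumWords-+ : ∀ L (f g : List Step → ℤ) →
             sumWords L (λ w → f w + g w) ≡ sumWords L f + sumWords L g
sumWords-+ zero    f g = refl
sumWords-+ (suc L) f g
  rewrite sumWords-+ L (λ w → f (U ∷ w)) (λ w → g (U ∷ w))
        | sumWords-+ L (λ w → f (H ∷ w)) (λ w → g (H ∷ w))
        | sumWords-+ L (λ w → f (D ∷ w)) (λ w → g (D ∷ w))
  = regroup (sumWords L (λ w → f (U ∷ w))) (sumWords L (λ w → g (U ∷ w)))
            (sumWords L (λ w → f (H ∷ w))) (sumWords L (λ w → g (H ∷ w)))
            (sumWords L (λ w → f (D ∷ w))) (sumWords L (λ w → g (D ∷ w)))
  where
  regroup : ∀ a b c d e f → a + b + (c + d) + (e + f) ≡ a + c + e + (b + d + f)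
  regroup = solve-∀

sumWords-+₅ : ∀ L (a b c d e : List Step → ℤ) →
  sumWords L (λ w → a w + b w + c w + d w + e w) ≡
  sumWords L a + sumWords L b + sumWords L c + sumWords L d + sumWords L e
sumWords-+₅ L a b c d e =
  trans (sumWords-+ L _ e) (cong (_+ sumWords L e)
  (trans (sumWords-+ L _ d) (cong (_+ sumWords L d)
  (trans (sumWords-+ L _ c) (cong (_+ sumWords L c) (sumWords-+ L a b))))))

sumWords-*ˡ : ∀ L c (f : List Step → ℤ) → sumWords L (λ w → c * f w) ≡ c * sumWords L f
sumWords-*ˡ zero    c f = refl
sumWords-*ˡ (suc L) c f
  rewrite sumWords-*ˡ L c (λ w → f (U ∷ w))
        | sumWords-*ˡ L c (λ w → f (H ∷ w))
        | sumWords-*ˡ L c (λ w → f (D ∷ w))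
  = factor c _ _ _
  where
  factor : ∀ c a b d → c * a + c * b + c * d ≡ c * (a + b + d)
  factor = solve-∀

sumWords-*ʳ : ∀ L c (f : List Step → ℤ) → sumWords L (λ w → f w * c) ≡ sumWords L f * c
sumWords-*ʳ L c f = begin
  sumWords L (λ w → f w * c)  ≡⟨ sumWords-cong L (λ w _ → ℤ.*-comm (f w) c) ⟩
  sumWords L (λ w → c * f w)  ≡⟨ sumWords-*ˡ L c f ⟩
  c * sumWords L f            ≡⟨ ℤ.*-comm c _ ⟩
  sumWords L f * c            ∎
  where open ≡-Reasoning

sumWords-scale : ∀ L c (x f : List Step → ℤ) → sumWords L (λ w → c * x w * f w) ≡ c * sumWords L (λ w → x w * f w)
sumWords-scale L c x f = trans (sumWords-cong L (λ w _ → ℤ.*-assoc c (x w) (f w))) (sumWords-*ˡ L c _)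

sumWords-comm : ∀ L L′ (F : List Step → List Step → ℤ) →
  sumWords L (λ w → sumWords L′ (F w)) ≡ sumWords L′ (λ u → sumWords L (λ w → F w u))
sumWords-comm zero    L′ F = refl
sumWords-comm (suc L) L′ F
  rewrite sumWords-comm L L′ (λ w → F (U ∷ w))
        | sumWords-comm L L′ (λ w → F (H ∷ w))
        | sumWords-comm L L′ (λ w → F (D ∷ w))
  = sym (trans (sumWords-+ L′ _ (λ u → sumWords L (λ w → F (D ∷ w) u)))
               (cong (_+ sumWords L′ (λ u → sumWords L (λ w → F (D ∷ w) u))) (sumWords-+ L′ _ _)))

sumWords-sumTo : ∀ L k (F : List Step → ℕ → ℤ) →
  sumWords L (λ w → sumTo k (F w)) ≡ sumTo k (λ i → sumWords L (λ w → F w i))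
sumWords-sumTo L zero    F = refl
sumWords-sumTo L (suc k) F =
  trans (sumWords-+ L _ (λ w → F w (suc k))) (cong (_+ sumWords L (λ w → F w (suc k))) (sumWords-sumTo L k F))

sumWords-sum³ : ∀ L k n m (F : List Step → ℕ → ℕ → ℕ → ℤ) →
  sumWords L (λ w → sum³ k n m (F w)) ≡ sum³ k n m (λ i j l → sumWords L (λ w → F w i j l))
sumWords-sum³ L k n m F =
  trans (sumWords-sumTo L k _) (sumTo-cong k λ i _ →
  trans (sumWords-sumTo L n _) (sumTo-cong n λ j _ → sumWords-sumTo L m _))

sumWords-linear : ∀ L L′ (F : List Step → List Step → ℤ) (f : List Step → ℤ) →
  sumWords L (λ w → sumWords L′ (λ u → F u w) * f w) ≡ sumWords L′ (λ u → sumWords L (λ w → F u w * f w))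
sumWords-linear L L′ F f =
  trans (sumWords-cong L (λ w _ → sym (sumWords-*ʳ L′ (f w) (λ u → F u w)))) (sumWords-comm L L′ _)

sumTo-linear : ∀ L N (F : ℕ → List Step → ℤ) (f : List Step → ℤ) →
  sumWords L (λ w → sumTo N (λ i → F i w) * f w) ≡ sumTo N (λ i → sumWords L (λ w → F i w * f w))
sumTo-linear L N F f =
  trans (sumWords-cong L (λ w _ → sym (sumTo-*ʳ N (f w) (λ i → F i w)))) (sumWords-sumTo L N _)

sumWords-δ : ∀ L u → sumWords L (δ u) ≡ 𝕀 (length u ≡ᵇ L)
sumWords-δ zero    []      = refl
sumWords-δ zero    (_ ∷ _) = refl
sumWords-δ (suc L) []      rewrite sumWords-zero L = refl
sumWords-δ (suc L) (x ∷ u) = begin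
  sumWords L (λ w → δ (x ∷ u) (U ∷ w)) + sumWords L (λ w → δ (x ∷ u) (H ∷ w))
    + sumWords L (λ w → δ (x ∷ u) (D ∷ w))
    ≡⟨ cong₂ _+_ (cong₂ _+_ (step U) (step H)) (step D) ⟩
  𝕀 (does (x ≟ˢ U)) * 𝕀 (length u ≡ᵇ L) + 𝕀 (does (x ≟ˢ H)) * 𝕀 (length u ≡ᵇ L)
    + 𝕀 (does (x ≟ˢ D)) * 𝕀 (length u ≡ᵇ L)
    ≡⟨ one-match x (𝕀 (length u ≡ᵇ L)) ⟩
  𝕀 (length u ≡ᵇ L) ∎
  where
  open ≡-Reasoning
  step : ∀ y → sumWords L (λ w → δ (x ∷ u) (y ∷ w)) ≡ 𝕀 (does (x ≟ˢ y)) * 𝕀 (length u ≡ᵇ L)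
  step y = trans (sumWords-cong L (λ w _ → δ-∷ x y u w))
                 (trans (sumWords-*ˡ L (𝕀 (does (x ≟ˢ y))) (δ u)) (cong (𝕀 (does (x ≟ˢ y)) *_) (sumWords-δ L u)))
  one-match : ∀ x a → 𝕀 (does (x ≟ˢ U)) * a + 𝕀 (does (x ≟ˢ H)) * a + 𝕀 (does (x ≟ˢ D)) * a ≡ a
  one-match U = solve-∀
  one-match H = solve-∀
  one-match D = solve-∀

δ-*-subst : ∀ v w (f : List Step → ℤ) → δ v w * f w ≡ δ v w * f v
δ-*-subst v w f with v ≟ʷ w
... | yes refl = refl
... | no  _    = refl

sumWords-δ-* : ∀ L v (f : List Step → ℤ) → sumWords L (λ w → δ v w * f w) ≡ 𝕀 (length v ≡ᵇ L) * f v
sumWords-δ-* L v f = begin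
  sumWords L (λ w → δ v w * f w)  ≡⟨ sumWords-cong L (λ w _ → δ-*-subst v w f) ⟩
  sumWords L (λ w → δ v w * f v)  ≡⟨ sumWords-*ʳ L (f v) (δ v) ⟩
  sumWords L (δ v) * f v          ≡⟨ cong (_* f v) (sumWords-δ L v) ⟩
  𝕀 (length v ≡ᵇ L) * f v         ∎
  where open ≡-Reasoning

sumList : List (List Step) → (List Step → ℤ) → ℤ
sumList ws f = foldr (λ w s → f w + s) 0ℤ ws

length-filterᵇ : ∀ p ws → + length (filterᵇ p ws) ≡ sumList ws (λ w → 𝕀 (p w))
length-filterᵇ p []       = refl
length-filterᵇ p (w ∷ ws) with p w
... | true  = cong (_+_ (+ 1)) (length-filterᵇ p ws)
... | false = trans (length-filterᵇ p ws) (sym (ℤ.+-identityˡ _))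

sumList-++ : ∀ vs ws f → sumList (vs ++ ws) f ≡ sumList vs f + sumList ws f
sumList-++ []       ws f = sym (ℤ.+-identityˡ _)
sumList-++ (v ∷ vs) ws f = trans (cong (_+_ (f v)) (sumList-++ vs ws f)) (sym (ℤ.+-assoc (f v) _ _))

sumList-concatMap : ∀ (g : List Step → List (List Step)) ws f →
  sumList (concatMap g ws) f ≡ sumList ws (λ w → sumList (g w) f)
sumList-concatMap g []       f = refl
sumList-concatMap g (w ∷ ws) f =
  trans (sumList-++ (g w) _ f) (cong (_+_ (sumList (g w) f)) (sumList-concatMap g ws f))

sumList-allWords : ∀ L f → sumList (allWords L) f ≡ sumWords L f
sumList-allWords zero    f = ℤ.+-identityʳ (f [])
sumList-allWords (suc L) f = begin
  sumList (allWords (suc L)) f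
    ≡⟨ sumList-concatMap _ (allWords L) f ⟩
  sumList (allWords L) (λ w → f (U ∷ w) + (f (H ∷ w) + (f (D ∷ w) + 0ℤ)))
    ≡⟨ sumList-allWords L _ ⟩
  sumWords L (λ w → f (U ∷ w) + (f (H ∷ w) + (f (D ∷ w) + 0ℤ)))
    ≡⟨ sumWords-cong L (λ w _ → regroup (f (U ∷ w)) (f (H ∷ w)) (f (D ∷ w))) ⟩
  sumWords L (λ w → f (U ∷ w) + f (H ∷ w) + f (D ∷ w))
    ≡⟨ sumWords-+ L _ (λ w → f (D ∷ w)) ⟩
  sumWords L (λ w → f (U ∷ w) + f (H ∷ w)) + sumWords L (λ w → f (D ∷ w))
    ≡⟨ cong (_+ sumWords L (λ w → f (D ∷ w))) (sumWords-+ L _ _) ⟩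
  sumWords (suc L) f ∎
  where
  open ≡-Reasoning
  regroup : ∀ a b c → a + (b + (c + 0ℤ)) ≡ a + b + c
  regroup = solve-∀

level : ℕ → List Step → Maybe ℕ
level h       []      = just h
level zero    (_ ∷ _) = nothing
level (suc h) (U ∷ w) = level (suc (suc h)) w
level (suc h) (H ∷ w) = level (suc h) w
level (suc h) (D ∷ w) = level h w

inner⇒level : ∀ h w → T (inner h w) → level h w ≡ just 0
inner⇒level zero    []      _ = refl
inner⇒level (suc h) (U ∷ w) p = inner⇒level (suc (suc h)) w p
inner⇒level (suc h) (H ∷ w) p = inner⇒level (suc h) w p
inner⇒level (suc h) (D ∷ w) p = inner⇒level h w p

level⇒inner : ∀ h w → level h w ≡ just 0 → T (inner h w)
level⇒inner zero    []      _ = _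
level⇒inner (suc h) (U ∷ w) p = level⇒inner (suc (suc h)) w p
level⇒inner (suc h) (H ∷ w) p = level⇒inner (suc h) w p
level⇒inner (suc h) (D ∷ w) p = level⇒inner h w p

level-++ : ∀ h {h′} p s → level h p ≡ just h′ → level h (p ++ s) ≡ level h′ s
level-++ h       []      s refl = refl
level-++ (suc h) (U ∷ p) s eq   = level-++ (suc (suc h)) p s eq
level-++ (suc h) (H ∷ p) s eq   = level-++ (suc h) p s eq
level-++ (suc h) (D ∷ p) s eq   = level-++ h p s eq

level-++⁻ : ∀ h {h″} p s → level h (p ++ s) ≡ just h″ →
            ∃ λ h′ → level h p ≡ just h′ × level h′ s ≡ just h″
level-++⁻ h       []      s eq = h , refl , eq
level-++⁻ (suc h) (U ∷ p) s eq = level-++⁻ (suc (suc h)) p s eq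
level-++⁻ (suc h) (H ∷ p) s eq = level-++⁻ (suc h) p s eq
level-++⁻ (suc h) (D ∷ p) s eq = level-++⁻ h p s eq

level-suc : ∀ h {h′} w → level h w ≡ just h′ → level (suc h) w ≡ just (suc h′)
level-suc h       []      refl = refl
level-suc (suc h) (U ∷ w) eq   = level-suc (suc (suc h)) w eq
level-suc (suc h) (H ∷ w) eq   = level-suc (suc h) w eq
level-suc (suc h) (D ∷ w) eq   = level-suc h w eq

level-zero-∷ʳ : ∀ s x → level 0 (s ∷ʳ x) ≢ just 0
level-zero-∷ʳ []      x ()
level-zero-∷ʳ (_ ∷ _) x ()

level-∷ʳ-U : ∀ p → level 1 (p ∷ʳ U) ≢ just 1
level-∷ʳ-U p eq with level-++⁻ 1 p (U ∷ []) eq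
... | zero  , _ , ()
... | suc _ , _ , ()

level-∷ʳ-H : ∀ p → level 1 (p ∷ʳ H) ≡ just 1 → level 1 p ≡ just 1
level-∷ʳ-H p eq with level-++⁻ 1 p (H ∷ []) eq
... | suc zero , returns , _ = returns

#D : List Step → ℕ
#D []      = 0
#D (D ∷ w) = suc (#D w)
#D (_ ∷ w) = #D w

level-balance : ∀ h {h′} w → level h w ≡ just h′ → h ℕ.+ #U w ≡ h′ ℕ.+ #D w
level-balance h       []      refl = refl
level-balance (suc h) (U ∷ w) eq   = trans (ℕ.+-suc (suc h) (#U w)) (level-balance (suc (suc h)) w eq)
level-balance (suc h) (H ∷ w) eq   = level-balance (suc h) w eq
level-balance (suc h) {h′} (D ∷ w) eq =
  trans (cong suc (level-balance h w eq)) (sym (ℕ.+-suc h′ (#D w)))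

length-steps : ∀ w → length w ≡ #U w ℕ.+ #H w ℕ.+ #D w
length-steps []      = refl
length-steps (U ∷ w) = cong suc (length-steps w)
length-steps (H ∷ w) = trans (cong suc (length-steps w)) (cong (ℕ._+ #D w) (sym (ℕ.+-suc (#U w) (#H w))))
length-steps (D ∷ w) = trans (cong suc (length-steps w)) (sym (ℕ.+-suc (#U w ℕ.+ #H w) (#D w)))

#H-++ : ∀ p s → #H (p ++ s) ≡ #H p ℕ.+ #H s
#H-++ []      s = refl
#H-++ (U ∷ p) s = #H-++ p s
#H-++ (H ∷ p) s = cong suc (#H-++ p s)
#H-++ (D ∷ p) s = #H-++ p s

#U-++ : ∀ p s → #U (p ++ s) ≡ #U p ℕ.+ #U s
#U-++ []      s = refl
#U-++ (U ∷ p) s = cong suc (#U-++ p s)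
#U-++ (H ∷ p) s = #U-++ p s
#U-++ (D ∷ p) s = #U-++ p s

turn : Step → Step → Bool
turn U D = true
turn D U = true
turn _ _ = false

noUDDU-∷∷ : ∀ x y s → noUDDU (x ∷ y ∷ s) ≡ not (turn x y) ∧ noUDDU (y ∷ s)
noUDDU-∷∷ U U s = refl
noUDDU-∷∷ U H s = refl
noUDDU-∷∷ U D s = refl
noUDDU-∷∷ H y s = refl
noUDDU-∷∷ D U s = refl
noUDDU-∷∷ D H s = refl
noUDDU-∷∷ D D s = refl

noUDDU-[-] : ∀ x → noUDDU (x ∷ []) ≡ true
noUDDU-[-] U = refl
noUDDU-[-] H = refl
noUDDU-[-] D = refl

noUDDU-++ : ∀ p x s → noUDDU (p ++ x ∷ s) ≡ noUDDU (p ∷ʳ x) ∧ noUDDU (x ∷ s)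
noUDDU-++ []          x s = cong (_∧ noUDDU (x ∷ s)) (sym (noUDDU-[-] x))
noUDDU-++ (U ∷ [])    U s = refl
noUDDU-++ (U ∷ [])    H s = refl
noUDDU-++ (U ∷ [])    D s = refl
noUDDU-++ (H ∷ [])    U s = refl
noUDDU-++ (H ∷ [])    H s = refl
noUDDU-++ (H ∷ [])    D s = refl
noUDDU-++ (D ∷ [])    U s = refl
noUDDU-++ (D ∷ [])    H s = refl
noUDDU-++ (D ∷ [])    D s = refl
noUDDU-++ (y ∷ z ∷ p) x s = begin
  noUDDU (y ∷ z ∷ p ++ x ∷ s)                                   ≡⟨ noUDDU-∷∷ y z _ ⟩
  not (turn y z) ∧ noUDDU (z ∷ p ++ x ∷ s)                      ≡⟨ cong (not (turn y z) ∧_) (noUDDU-++ (z ∷ p) x s) ⟩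
  not (turn y z) ∧ (noUDDU (z ∷ p ∷ʳ x) ∧ noUDDU (x ∷ s))       ≡⟨ ∧-assoc (not (turn y z)) _ _ ⟨
  (not (turn y z) ∧ noUDDU (z ∷ p ∷ʳ x)) ∧ noUDDU (x ∷ s)       ≡⟨ cong (_∧ noUDDU (x ∷ s)) (noUDDU-∷∷ y z _) ⟨
  noUDDU (y ∷ z ∷ p ∷ʳ x) ∧ noUDDU (x ∷ s)                      ∎
  where open ≡-Reasoning

noUDDU-++⁻ : ∀ p x s → T (noUDDU (p ++ x ∷ s)) → T (noUDDU (p ∷ʳ x)) × T (noUDDU (x ∷ s))
noUDDU-++⁻ p x s h = Equivalence.to (T-∧ {noUDDU (p ∷ʳ x)}) (subst T (noUDDU-++ p x s) h)

noUDDU-++⁺ : ∀ p x s → T (noUDDU (p ∷ʳ x)) → T (noUDDU (x ∷ s)) → T (noUDDU (p ++ x ∷ s))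
noUDDU-++⁺ p x s h₁ h₂ = subst T (sym (noUDDU-++ p x s)) (Equivalence.from T-∧ (h₁ , h₂))

noUDDU-init : ∀ p x → T (noUDDU (p ∷ʳ x)) → T (noUDDU p)
noUDDU-init p x h with initLast p
... | []      = _
... | q ∷ʳ′ y = proj₁ (noUDDU-++⁻ q y (x ∷ []) (subst (T ∘ noUDDU) (List.++-assoc q (y ∷ []) (x ∷ [])) h))

noUDDU-∷ʳ-H : ∀ p → noUDDU (p ∷ʳ H) ≡ noUDDU p
noUDDU-∷ʳ-H []          = refl
noUDDU-∷ʳ-H (U ∷ [])    = refl
noUDDU-∷ʳ-H (H ∷ [])    = refl
noUDDU-∷ʳ-H (D ∷ [])    = refl
noUDDU-∷ʳ-H (x ∷ y ∷ p) =
  trans (noUDDU-∷∷ x y (p ∷ʳ H)) (trans (cong (not (turn x y) ∧_) (noUDDU-∷ʳ-H (y ∷ p))) (sym (noUDDU-∷∷ x y p)))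

noUDDU-∷ʳ-D : ∀ p → T (noUDDU p) → (∀ q → p ≢ q ∷ʳ U) → T (noUDDU (p ∷ʳ D))
noUDDU-∷ʳ-D p h p≢ with initLast p
... | []      = _
... | q ∷ʳ′ U = ⊥-elim (p≢ q refl)
... | q ∷ʳ′ H = subst (T ∘ noUDDU) (sym (List.++-assoc q (H ∷ []) (D ∷ []))) (noUDDU-++⁺ q H (D ∷ []) h _)
... | q ∷ʳ′ D = subst (T ∘ noUDDU) (sym (List.++-assoc q (D ∷ []) (D ∷ []))) (noUDDU-++⁺ q D (D ∷ []) h _)

uhu-++-D : ∀ p s → uhu (p ++ D ∷ s) ≡ uhu p ℕ.+ uhu s
uhu-++-D []                  s = refl
uhu-++-D (U ∷ [])            s = refl
uhu-++-D (U ∷ H ∷ [])        s = refl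
uhu-++-D (U ∷ H ∷ U ∷ p)     s = cong suc (uhu-++-D (H ∷ U ∷ p) s)
uhu-++-D (U ∷ H ∷ H ∷ p)     s = uhu-++-D (H ∷ H ∷ p) s
uhu-++-D (U ∷ H ∷ D ∷ p)     s = uhu-++-D (H ∷ D ∷ p) s
uhu-++-D (U ∷ U ∷ p)         s = uhu-++-D (U ∷ p) s
uhu-++-D (U ∷ D ∷ p)         s = uhu-++-D (D ∷ p) s
uhu-++-D (H ∷ p)             s = uhu-++-D p s
uhu-++-D (D ∷ p)             s = uhu-++-D p s

uhu-++-H : ∀ p s → (∀ q → p ≢ q ∷ʳ U) → uhu (p ++ H ∷ s) ≡ uhu p ℕ.+ uhu s
uhu-++-H []              s _   = refl
uhu-++-H (U ∷ [])        s p≢ = ⊥-elim (p≢ [] refl)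
uhu-++-H (U ∷ H ∷ [])    s _   = refl
uhu-++-H (U ∷ H ∷ U ∷ p) s p≢ = cong suc (uhu-++-H (H ∷ U ∷ p) s (λ q eq → p≢ (U ∷ q) (cong (U ∷_) eq)))
uhu-++-H (U ∷ H ∷ H ∷ p) s p≢ = uhu-++-H (H ∷ H ∷ p) s (λ q eq → p≢ (U ∷ q) (cong (U ∷_) eq))
uhu-++-H (U ∷ H ∷ D ∷ p) s p≢ = uhu-++-H (H ∷ D ∷ p) s (λ q eq → p≢ (U ∷ q) (cong (U ∷_) eq))
uhu-++-H (U ∷ U ∷ p)     s p≢ = uhu-++-H (U ∷ p) s (λ q eq → p≢ (U ∷ q) (cong (U ∷_) eq))
uhu-++-H (U ∷ D ∷ p)     s p≢ = uhu-++-H (D ∷ p) s (λ q eq → p≢ (U ∷ q) (cong (U ∷_) eq))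
uhu-++-H (H ∷ p)         s p≢ = uhu-++-H p s (λ q eq → p≢ (H ∷ q) (cong (H ∷_) eq))
uhu-++-H (D ∷ p)         s p≢ = uhu-++-H p s (λ q eq → p≢ (D ∷ q) (cong (D ∷_) eq))

uhu-∷ʳ-D : ∀ p → uhu (p ∷ʳ D) ≡ uhu p
uhu-∷ʳ-D p = trans (uhu-++-D p []) (ℕ.+-identityʳ (uhu p))

#H-∷ʳ-D : ∀ p → #H (p ∷ʳ D) ≡ #H p
#H-∷ʳ-D p = trans (#H-++ p (D ∷ [])) (ℕ.+-identityʳ (#H p))

#U-∷ʳ-D : ∀ p → #U (p ∷ʳ D) ≡ #U p
#U-∷ʳ-D p = trans (#U-++ p (D ∷ [])) (ℕ.+-identityʳ (#U p))

-- Bargraphs and their bodies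

-- A record rather than T (isBargraph w), so that w can be inferred from a proof.
record Bargraph (w : List Step) : Set where
  constructor bargraph
  field isBar : T (isBargraph w)

raise : List Step → List Step
raise a = U ∷ a ++ D ∷ []

record Body (a : List Step) : Set where
  field
    returns : level 1 a ≡ just 1
    smooth  : T (noUDDU (raise a))
open Body

body⇒bargraph : ∀ {a} → Body a → Bargraph (raise a)
body⇒bargraph {a} b = bargraph $
  Equivalence.from (T-∧ {inner 1 (a ++ D ∷ [])})
    (level⇒inner 1 (a ++ D ∷ []) (level-++ 1 a (D ∷ []) (returns b)) , smooth b)

bargraph⇒body : ∀ {w} → Bargraph w → ∃ λ a → w ≡ raise a × Body a
bargraph⇒body {U ∷ r} (bargraph bg) with Equivalence.to (T-∧ {inner 1 r}) bg
... | above , smooth with initLast r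
...   | [] with () ← inner⇒level 1 [] above
...   | a ∷ʳ′ c with level-++⁻ 1 a (c ∷ []) (inner⇒level 1 (a ∷ʳ c) above)
...     | h , returns , last with h | c | last
...       | suc zero | D | _ = a , refl , record { returns = returns ; smooth = smooth }
...       | zero     | _ | ()
...       | suc (suc _) | D | ()
...       | suc _    | U | ()
...       | suc _    | H | ()

raise-injective : ∀ {a b} → raise a ≡ raise b → a ≡ b
raise-injective {a} {b} eq = List.∷ʳ-injectiveˡ a b (List.∷-injectiveʳ eq)

raise-++ : ∀ x y t → raise (x ++ y ∷ t) ≡ (U ∷ x) ++ y ∷ t ++ D ∷ []
raise-++ x y t = cong (U ∷_) (List.++-assoc x (y ∷ t) (D ∷ []))

length-raise : ∀ a → length (raise a) ≡ suc (suc (length a))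
length-raise a = cong suc (trans (List.length-++ a) (ℕ.+-comm (length a) 1))

bargraph-returns : ∀ {u} → Bargraph u → level 1 u ≡ just 1
bargraph-returns bg with bargraph⇒body bg
... | a , refl , b = level-suc 1 (a ++ D ∷ []) (level-++ 1 a (D ∷ []) (returns b))

bargraph-length : ∀ {u} → Bargraph u → length u ≡ #H u ℕ.+ (#U u ℕ.+ #U u)
bargraph-length {u} bg = begin
  length u                       ≡⟨ length-steps u ⟩
  #U u ℕ.+ #H u ℕ.+ #D u         ≡⟨ cong (#U u ℕ.+ #H u ℕ.+_) #D≡#U ⟨
  #U u ℕ.+ #H u ℕ.+ #U u         ≡⟨ regroup (#U u) (#H u) ⟩
  #H u ℕ.+ (#U u ℕ.+ #U u)       ∎
  where
  open ≡-Reasoning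
  #D≡#U : #U u ≡ #D u
  #D≡#U = ℕ.suc-injective (level-balance 1 u (bargraph-returns bg))
  regroup : ∀ x y → x ℕ.+ y ℕ.+ x ≡ y ℕ.+ (x ℕ.+ x)
  regroup = ℕ-Solver.solve-∀

bargraph-nonempty : ∀ {u} → Bargraph u → length u ≢ 0
bargraph-nonempty bg with bargraph⇒body bg
... | _ , refl , _ = λ ()

body-nonempty : ∀ {a} → Body a → a ≢ []
body-nonempty b refl = smooth b

returning-last≢U : ∀ {p} → p ≢ [] → level 1 p ≡ just 1 → ∀ q → U ∷ p ≢ q ∷ʳ U
returning-last≢U p≢[] lp []      eq = p≢[] (List.∷-injectiveʳ eq)
returning-last≢U p≢[] lp (_ ∷ q) eq = level-∷ʳ-U q (trans (cong (level 1) (sym (List.∷-injectiveʳ eq))) lp)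

body-last≢U : ∀ {a} → Body a → ∀ q → U ∷ a ≢ q ∷ʳ U
body-last≢U b = returning-last≢U (body-nonempty b) (returns b)

body-noUDDU : ∀ {a} → Body a → T (noUDDU (U ∷ a))
body-noUDDU {a} b = noUDDU-init (U ∷ a) D (smooth b)

bargraph-∷ʳ-D : ∀ {u} → Bargraph u → T (noUDDU (u ∷ʳ D))
bargraph-∷ʳ-D bg with bargraph⇒body bg
... | a , refl , b = subst (T ∘ noUDDU) (cong (U ∷_) (sym (List.++-assoc a (D ∷ []) (D ∷ []))))
                           (noUDDU-++⁺ (U ∷ a) D (D ∷ []) (smooth b) _)

bargraph-body : ∀ {u} → Bargraph u → Body u
bargraph-body bg with bargraph⇒body bg
... | a , refl , _ = record { returns = bargraph-returns bg ; smooth = bargraph-∷ʳ-D bg }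

body-++-H : ∀ {a s} → Body a → level 1 s ≡ just 1 → T (noUDDU (s ∷ʳ D)) → Body (a ++ H ∷ s)
body-++-H {a} {s} b ls ns = record
  { returns = trans (level-++ 1 a (H ∷ s) (returns b)) ls
  ; smooth  = subst (T ∘ noUDDU) (sym (raise-++ a H s))
                (noUDDU-++⁺ (U ∷ a) H (s ∷ʳ D) (subst T (sym (noUDDU-∷ʳ-H (U ∷ a))) (body-noUDDU b)) ns)
  }

body-prefix : ∀ p → p ≢ [] → level 1 p ≡ just 1 → T (noUDDU (U ∷ p)) → Body p
body-prefix p p≢[] lp np = record
  { returns = lp ; smooth = noUDDU-∷ʳ-D (U ∷ p) np (returning-last≢U p≢[] lp) }

excursion-bargraph : ∀ r → level 1 r ≡ just 0 → T (noUDDU (U ∷ r ∷ʳ D)) → Bargraph (U ∷ r)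
excursion-bargraph r lr nr =
  bargraph (Equivalence.from (T-∧ {inner 1 r}) (level⇒inner 1 r lr , noUDDU-init (U ∷ r) D nr))

bargraph-no-early-return : ∀ x v → Bargraph (x ++ H ∷ v) → level 1 x ≢ just 1
bargraph-no-early-return (U ∷ x) v (bargraph bg) eq
  with level-++⁻ 1 x (H ∷ v) (inner⇒level 1 (x ++ H ∷ v) (proj₁ (Equivalence.to (T-∧ {inner 1 (x ++ H ∷ v)}) bg)))
... | suc h , returns , _ with () ← trans (sym eq) (level-suc 1 x returns)

-- Either the walk stays above height 1 until its end, or it is cut just before the last U step
-- it takes from height 1.
last-excursion : ∀ h s → level h (s ∷ʳ D) ≡ just 1 →
  (∃ λ h₀ → h ≡ suc h₀ × level h₀ (s ∷ʳ D) ≡ just 0) ⊎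
  (∃₂ λ x r → s ∷ʳ D ≡ x ++ U ∷ r × level h x ≡ just 1 × level 1 r ≡ just 0)
last-excursion (suc h) [] refl = inj₁ (1 , refl , refl)
last-excursion (suc h) (U ∷ s) eq with last-excursion (suc (suc h)) s eq
... | inj₂ (x , r , e , lx , lr) = inj₂ (U ∷ x , r , cong (U ∷_) e , lx , lr)
... | inj₁ (_ , refl , l₀) with h
...   | zero   = inj₂ ([] , s ∷ʳ D , refl , refl , l₀)
...   | suc h′ = inj₁ (suc h′ , refl , l₀)
last-excursion (suc h) (H ∷ s) eq with last-excursion (suc h) s eq
... | inj₂ (x , r , e , lx , lr) = inj₂ (H ∷ x , r , cong (H ∷_) e , lx , lr)
... | inj₁ (_ , refl , l₀) with h
...   | zero   = ⊥-elim (level-zero-∷ʳ s D l₀)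
...   | suc h′ = inj₁ (suc h′ , refl , l₀)
last-excursion (suc h) (D ∷ s) eq with last-excursion h s eq
... | inj₂ (x , r , e , lx , lr) = inj₂ (D ∷ x , r , cong (D ∷_) e , lx , lr)
... | inj₁ (h₀ , refl , l₀) = inj₁ (suc h₀ , refl , l₀)

-- The five constructions

unitBar : List Step
unitBar = U ∷ H ∷ D ∷ []

ledge : List Step → List Step
ledge u = raise (H ∷ u)

insertLast : List Step → List Step → List Step
insertLast r []          = r
insertLast r (x ∷ [])    = r ∷ʳ x
insertLast r (x ∷ y ∷ s) = x ∷ insertLast r (y ∷ s)

graft : List Step → List Step → List Step
graft u v = insertLast (H ∷ v) u

widen : List Step → List Step
widen u = graft u []

insertLast-∷ʳ : ∀ r p x → insertLast r (p ∷ʳ x) ≡ p ++ r ∷ʳ x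
insertLast-∷ʳ r []          x = refl
insertLast-∷ʳ r (y ∷ [])    x = refl
insertLast-∷ʳ r (y ∷ z ∷ p) x = cong (y ∷_) (insertLast-∷ʳ r (z ∷ p) x)

length-insertLast : ∀ r u → length (insertLast r u) ≡ length r ℕ.+ length u
length-insertLast r []          = sym (ℕ.+-identityʳ (length r))
length-insertLast r (x ∷ [])    = List.length-++ r
length-insertLast r (x ∷ y ∷ s) = trans (cong suc (length-insertLast r (y ∷ s))) (sym (ℕ.+-suc (length r) _))

graft-raise : ∀ a v → graft (raise a) v ≡ raise (a ++ H ∷ v)
graft-raise a v = trans (insertLast-∷ʳ (H ∷ v) (U ∷ a) D) (sym (raise-++ a H v))

raise-bargraph : ∀ {u} → Bargraph u → Bargraph (raise u)
raise-bargraph bg = body⇒bargraph (bargraph-body bg)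

ledge-bargraph : ∀ {u} → Bargraph u → Bargraph (ledge u)
ledge-bargraph {u} bg =
  body⇒bargraph {H ∷ u} (record { returns = bargraph-returns bg ; smooth = bargraph-∷ʳ-D bg })

graft-bargraph′ : ∀ {u s} → Bargraph u → level 1 s ≡ just 1 → T (noUDDU (s ∷ʳ D)) →
                  Bargraph (graft u s)
graft-bargraph′ {s = s} bg ls ns with bargraph⇒body bg
... | a , refl , b = subst Bargraph (sym (graft-raise a s)) (body⇒bargraph (body-++-H b ls ns))

graft-bargraph : ∀ {u v} → Bargraph u → Bargraph v → Bargraph (graft u v)
graft-bargraph bgu bgv = graft-bargraph′ bgu (bargraph-returns bgv) (bargraph-∷ʳ-D bgv)

widen-bargraph : ∀ {u} → Bargraph u → Bargraph (widen u)
widen-bargraph bg = graft-bargraph′ bg refl _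

stats : List Step → ℕ × ℕ × ℕ
stats w = uhu w , #H w , #U w

stats-≡ : ∀ w {a b c} → uhu w ≡ a → #H w ≡ b → #U w ≡ c → stats w ≡ (a , b , c)
stats-≡ _ eu eh ed = cong₂ _,_ eu (cong₂ _,_ eh ed)

raise-stats : ∀ {u} → Bargraph u → stats (raise u) ≡ (0 , 0 , 1) +³ stats u
raise-stats bg with bargraph⇒body bg
... | a , refl , _ =
  stats-≡ (raise (raise a)) (uhu-∷ʳ-D (raise a)) (#H-∷ʳ-D (raise a)) (cong suc (#U-∷ʳ-D (raise a)))

ledge-stats : ∀ {u} → Bargraph u → stats (ledge u) ≡ (1 , 1 , 1) +³ stats u
ledge-stats bg with bargraph⇒body bg
... | a , refl , _ =
  stats-≡ (ledge (raise a))
    (cong suc (uhu-∷ʳ-D (raise a))) (cong suc (#H-∷ʳ-D (raise a))) (cong suc (#U-∷ʳ-D (raise a)))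

graft-stats : ∀ {u} v → Bargraph u → stats (graft u v) ≡ (0 , 1 , 0) +³ (stats u +³ stats v)
graft-stats v bg with bargraph⇒body bg
... | a , refl , b =
  trans (cong stats (insertLast-∷ʳ (H ∷ v) (U ∷ a) D)) $ stats-≡ ((U ∷ a) ++ H ∷ v ∷ʳ D)
  (begin
    uhu ((U ∷ a) ++ H ∷ v ∷ʳ D)       ≡⟨ uhu-++-H (U ∷ a) (v ∷ʳ D) (body-last≢U b) ⟩
    uhu (U ∷ a) ℕ.+ uhu (v ∷ʳ D)      ≡⟨ cong₂ ℕ._+_ (sym (uhu-∷ʳ-D (U ∷ a))) (uhu-∷ʳ-D v) ⟩
    uhu (raise a) ℕ.+ uhu v           ∎)
  (begin
    #H ((U ∷ a) ++ H ∷ v ∷ʳ D)        ≡⟨ #H-++ (U ∷ a) (H ∷ v ∷ʳ D) ⟩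
    #H (U ∷ a) ℕ.+ suc (#H (v ∷ʳ D))  ≡⟨ cong₂ (λ x y → x ℕ.+ suc y) (sym (#H-∷ʳ-D (U ∷ a))) (#H-∷ʳ-D v) ⟩
    #H (raise a) ℕ.+ suc (#H v)       ≡⟨ ℕ.+-suc (#H (raise a)) (#H v) ⟩
    suc (#H (raise a) ℕ.+ #H v)       ∎)
  (begin
    #U ((U ∷ a) ++ H ∷ v ∷ʳ D)        ≡⟨ #U-++ (U ∷ a) (H ∷ v ∷ʳ D) ⟩
    #U (U ∷ a) ℕ.+ #U (v ∷ʳ D)        ≡⟨ cong₂ ℕ._+_ (sym (#U-∷ʳ-D (U ∷ a))) (#U-∷ʳ-D v) ⟩
    #U (raise a) ℕ.+ #U v             ∎)
  where open ≡-Reasoning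

widen-stats : ∀ {u} → Bargraph u → stats (widen u) ≡ (0 , 1 , 0) +³ stats u
widen-stats {u} bg = trans (graft-stats [] bg) (cong ((0 , 1 , 0) +³_) (+³-identityʳ (stats u)))

-- Unique decomposition

++-H-split : ∀ a a′ (v v′ : List Step) → a ++ H ∷ v ≡ a′ ++ H ∷ v′ →
  (a ≡ a′ × v ≡ v′) ⊎
  (∃ λ s → a′ ≡ a ++ H ∷ s × v ≡ s ++ H ∷ v′) ⊎
  (∃ λ s → a ≡ a′ ++ H ∷ s × v′ ≡ s ++ H ∷ v)
++-H-split []      []       v v′ refl = inj₁ (refl , refl)
++-H-split []      (H ∷ a′) v v′ refl = inj₂ (inj₁ (a′ , refl , refl))
++-H-split (H ∷ a) []       v v′ refl = inj₂ (inj₂ (a , refl , refl))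
++-H-split (x ∷ a) (y ∷ a′) v v′ eq with List.∷-injective eq
... | refl , eq′ with ++-H-split a a′ v v′ eq′
...   | inj₁ (refl , refl)           = inj₁ (refl , refl)
...   | inj₂ (inj₁ (s , refl , eqv)) = inj₂ (inj₁ (s , refl , eqv))
...   | inj₂ (inj₂ (s , refl , eqv)) = inj₂ (inj₂ (s , refl , eqv))

body-++-H-injective : ∀ {a a′ v v′} → Body a → Body a′ → Bargraph v → Bargraph v′ →
                      a ++ H ∷ v ≡ a′ ++ H ∷ v′ → a ≡ a′ × v ≡ v′
body-++-H-injective {a} {a′} {v} {v′} b b′ bgv bgv′ eq with ++-H-split a a′ v v′ eq
... | inj₁ eqs = eqs
... | inj₂ (inj₁ (s , refl , refl)) =
  ⊥-elim (bargraph-no-early-return s v′ bgv (trans (sym (level-++ 1 a (H ∷ s) (returns b))) (returns b′)))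
... | inj₂ (inj₂ (s , refl , refl)) =
  ⊥-elim (bargraph-no-early-return s v bgv′ (trans (sym (level-++ 1 a′ (H ∷ s) (returns b′))) (returns b)))

ledge-injective : ∀ {u u′} → ledge u ≡ ledge u′ → u ≡ u′
ledge-injective eq = List.∷-injectiveʳ (raise-injective eq)

graft-injective : ∀ {u u′ v v′} → Bargraph u → Bargraph u′ → Bargraph v → Bargraph v′ →
                  graft u v ≡ graft u′ v′ → u ≡ u′ × v ≡ v′
graft-injective {v = v} {v′} bgu bgu′ bgv bgv′ eq with bargraph⇒body bgu | bargraph⇒body bgu′
... | a , refl , b | a′ , refl , b′ with body-++-H-injective b b′ bgv bgv′
                                          (raise-injective (trans (sym (graft-raise a v)) (trans eq (graft-raise a′ v′))))
...   | refl , refl = refl , refl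

widen-injective : ∀ {u u′} → Bargraph u → Bargraph u′ → widen u ≡ widen u′ → u ≡ u′
widen-injective bgu bgu′ eq with bargraph⇒body bgu | bargraph⇒body bgu′
... | a , refl , _ | a′ , refl , _ =
  cong raise (List.∷ʳ-injectiveˡ a a′ (raise-injective (trans (sym (graft-raise a [])) (trans eq (graft-raise a′ [])))))

BodyEndsIn : Step → List Step → Set
BodyEndsIn x w = ∃ λ p → w ≡ raise (p ∷ʳ x)

body-ends-unique : ∀ {x y w} → BodyEndsIn x w → BodyEndsIn y w → x ≡ y
body-ends-unique {x} {y} (p , refl) (q , eq) = List.∷ʳ-injectiveʳ p q (raise-injective eq)

ends-disjoint : ∀ {w w′} → BodyEndsIn H w → BodyEndsIn D w′ → w ≢ w′
ends-disjoint eH eD refl with () ← body-ends-unique eH eD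

unitBar-ends-H : BodyEndsIn H unitBar
unitBar-ends-H = [] , refl

widen-ends-H : ∀ {u} → Bargraph u → BodyEndsIn H (widen u)
widen-ends-H bg with bargraph⇒body bg
... | a , refl , _ = a , graft-raise a []

raise-ends-D : ∀ {u} → Bargraph u → BodyEndsIn D (raise u)
raise-ends-D bg with bargraph⇒body bg
... | a , refl , _ = U ∷ a , refl

ledge-ends-D : ∀ {u} → Bargraph u → BodyEndsIn D (ledge u)
ledge-ends-D bg with bargraph⇒body bg
... | a , refl , _ = H ∷ U ∷ a , refl

graft-ends-D : ∀ {u v} → Bargraph u → Bargraph v → BodyEndsIn D (graft u v)
graft-ends-D {v = v} bgu bgv with bargraph⇒body bgu | bargraph⇒body bgv
... | a , refl , _ | b , refl , _ =
  a ++ H ∷ U ∷ b , trans (graft-raise a (raise b)) (cong raise (sym (List.++-assoc a (H ∷ U ∷ b) (D ∷ []))))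

widen≢unitBar : ∀ {u} → Bargraph u → widen u ≢ unitBar
widen≢unitBar bg eq with bargraph⇒body bg
... | a , refl , b =
  body-nonempty b (List.∷ʳ-injectiveˡ a [] (raise-injective (trans (sym (graft-raise a [])) eq)))

raise≢ledge : ∀ {u u′} → Bargraph u → raise u ≢ ledge u′
raise≢ledge {u′ = u′} bg eq = Bargraph.isBar (subst Bargraph (raise-injective {b = H ∷ u′} eq) bg)

raise≢graft : ∀ {u u′ v′} → Bargraph u → Bargraph u′ → Bargraph v′ → raise u ≢ graft u′ v′
raise≢graft {v′ = v′} bgu bgu′ bgv′ eq with bargraph⇒body bgu′
... | a , refl , b = bargraph-no-early-return a v′
                       (subst Bargraph (raise-injective (trans eq (graft-raise a v′))) bgu) (returns b)

ledge≢graft : ∀ {u u′ v′} → Bargraph u → Bargraph u′ → Bargraph v′ → ledge u ≢ graft u′ v′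
ledge≢graft {u} {v′ = v′} bgu bgu′ bgv′ eq with bargraph⇒body bgu′
... | a , refl , b = split a b (raise-injective (trans eq (graft-raise a v′)))
  where
  split : ∀ a → Body a → H ∷ u ≡ a ++ H ∷ v′ → ⊥
  split []       b _   = body-nonempty b refl
  split (H ∷ a′) b eq′ =
    bargraph-no-early-return a′ v′ (subst Bargraph (List.∷-injectiveʳ eq′) bgu) (returns b)

data Decomposition : List Step → Set where
  unit    : Decomposition unitBar
  raised  : ∀ {u} → Bargraph u → Decomposition (raise u)
  widened : ∀ {u} → Bargraph u → Decomposition (widen u)
  ledged  : ∀ {u} → Bargraph u → Decomposition (ledge u)
  grafted : ∀ {u v} → Bargraph u → Bargraph v → Decomposition (graft u v)

decompose-∷ʳ-H : ∀ p → Body (p ∷ʳ H) → Decomposition (raise (p ∷ʳ H))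
decompose-∷ʳ-H []      _ = unit
decompose-∷ʳ-H p@(_ ∷ _) b =
  subst Decomposition (graft-raise p [])
    (widened (body⇒bargraph (body-prefix p (λ ()) (level-∷ʳ-H p (returns b))
      (subst T (noUDDU-∷ʳ-H (U ∷ p)) (noUDDU-init (U ∷ p ∷ʳ H) D (smooth b))))))

raise-∷ʳ-++ : ∀ x c t → raise ((x ∷ʳ c) ++ t) ≡ (U ∷ x) ++ c ∷ t ∷ʳ D
raise-∷ʳ-++ x c t =
  cong (U ∷_) (trans (List.++-assoc (x ∷ʳ c) t (D ∷ [])) (List.++-assoc x (c ∷ []) (t ∷ʳ D)))

decompose-excursion : ∀ x r → level 1 x ≡ just 1 → level 1 r ≡ just 0 →
                      T (noUDDU (raise (x ++ U ∷ r))) → Decomposition (raise (x ++ U ∷ r))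
decompose-excursion x r lx lr nw with initLast x
... | []       = raised (excursion-bargraph r lr nw)
... | x′ ∷ʳ′ U = ⊥-elim (level-∷ʳ-U x′ lx)
... | x′ ∷ʳ′ D = ⊥-elim (proj₂ (noUDDU-++⁻ (U ∷ x′) D (U ∷ r ∷ʳ D) (subst (T ∘ noUDDU) (raise-∷ʳ-++ x′ D (U ∷ r)) nw)))
... | x′ ∷ʳ′ H with noUDDU-++⁻ (U ∷ x′) H (U ∷ r ∷ʳ D) (subst (T ∘ noUDDU) (raise-∷ʳ-++ x′ H (U ∷ r)) nw)
...   | nx , nr with x′
...     | []     = ledged (excursion-bargraph r lr nr)
...     | y@(_ ∷ _) =
  subst Decomposition (trans (graft-raise y (U ∷ r)) (cong raise (sym (List.++-assoc y (H ∷ []) (U ∷ r)))))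
    (grafted (body⇒bargraph (body-prefix y (λ ()) (level-∷ʳ-H y lx) (subst T (noUDDU-∷ʳ-H (U ∷ y)) nx)))
             (excursion-bargraph r lr nr))

decompose-∷ʳ-D : ∀ p → Body (p ∷ʳ D) → Decomposition (raise (p ∷ʳ D))
decompose-∷ʳ-D p b with last-excursion 1 p (returns b)
... | inj₁ (_ , refl , l₀) = ⊥-elim (level-zero-∷ʳ p D l₀)
... | inj₂ (x , r , e , lx , lr) = subst Decomposition (cong raise (sym e))
        (decompose-excursion x r lx lr (subst (T ∘ noUDDU ∘ raise) e (smooth b)))

decompose : ∀ {w} → Bargraph w → Decomposition w
decompose bg with bargraph⇒body bg
... | b , refl , body with initLast b
...   | []       = ⊥-elim (body-nonempty body refl)
...   | p ∷ʳ′ U  = ⊥-elim (level-∷ʳ-U p (returns body))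
...   | p ∷ʳ′ H  = decompose-∷ʳ-H p body
...   | p ∷ʳ′ D  = decompose-∷ʳ-D p body

fibre : (List Step → List Step) → ℕ → List Step → ℤ
fibre φ L w = sumWords L (λ u → 𝕀 (isBargraph u) * δ (φ u) w)

fibre₂ : (List Step → List Step → List Step) → ℕ → List Step → ℤ
fibre₂ φ N w = sumTo N λ L₁ → sumWords L₁ λ u → sumWords (N ∸ L₁) λ v →
  𝕀 (isBargraph u) * (𝕀 (isBargraph v) * δ (φ u v) w)

fibre-empty : ∀ φ L {w} → (∀ {u} → Bargraph u → φ u ≢ w) → fibre φ L w ≡ 0ℤ
fibre-empty φ L φ≢ = trans
  (sumWords-cong L (λ u _ → 𝕀-*-zero (isBargraph u) (λ bg → δ-≢ (φ≢ (bargraph bg)))))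
  (sumWords-zero L)

fibre₂-empty : ∀ φ N {w} → (∀ {u v} → Bargraph u → Bargraph v → φ u v ≢ w) → fibre₂ φ N w ≡ 0ℤ
fibre₂-empty φ N φ≢ = trans
  (sumTo-cong N λ L₁ _ → trans (sumWords-cong L₁ λ u _ → trans (sumWords-cong (N ∸ L₁) λ v _ →
     𝕀-*-zero (isBargraph u) λ bgu → 𝕀-*-zero (isBargraph v) λ bgv → δ-≢ (φ≢ (bargraph bgu) (bargraph bgv)))
     (sumWords-zero (N ∸ L₁))) (sumWords-zero L₁))
  (sumTo-zero N)

fibre-single : ∀ φ L {u₀} → (∀ {u} → Bargraph u → φ u ≡ φ u₀ → u ≡ u₀) →
               Bargraph u₀ → length u₀ ≡ L → fibre φ L (φ u₀) ≡ + 1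
fibre-single φ L {u₀} injective bg₀ len = begin
  fibre φ L (φ u₀)     ≡⟨ sumWords-cong L (λ u _ → pointwise u) ⟩
  sumWords L (δ u₀)    ≡⟨ sumWords-δ L u₀ ⟩
  𝕀 (length u₀ ≡ᵇ L)   ≡⟨ 𝕀-true (ℕ.≡⇒≡ᵇ _ _ len) ⟩
  + 1                  ∎
  where
  open ≡-Reasoning
  pointwise : ∀ u → 𝕀 (isBargraph u) * δ (φ u) (φ u₀) ≡ δ u₀ u
  pointwise u with u₀ ≟ʷ u
  ... | yes refl = cong₂ _*_ (𝕀-true (Bargraph.isBar bg₀)) (δ-refl (φ u₀))
  ... | no u₀≢u  = 𝕀-*-zero (isBargraph u) (λ bg → δ-≢ (λ eq → u₀≢u (sym (injective (bargraph bg) eq))))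

fibre₂-single : ∀ φ N {u₀ v₀} → (∀ {u v} → Bargraph u → Bargraph v → φ u v ≡ φ u₀ v₀ → u ≡ u₀ × v ≡ v₀) →
                Bargraph u₀ → Bargraph v₀ → length u₀ ℕ.+ length v₀ ≡ N → fibre₂ φ N (φ u₀ v₀) ≡ + 1
fibre₂-single φ N {u₀} {v₀} injective bgu₀ bgv₀ len = begin
  fibre₂ φ N (φ u₀ v₀)
    ≡⟨ sumTo-cong N (λ L₁ _ → sumWords-cong L₁ λ u _ → sumWords-cong (N ∸ L₁) λ v _ → pointwise u v) ⟩
  sumTo N (λ L₁ → sumWords L₁ λ u → sumWords (N ∸ L₁) λ v → δ u₀ u * δ v₀ v)
    ≡⟨ sumTo-cong N (λ L₁ _ → sumWords-cong L₁ λ u _ →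
         trans (sumWords-*ˡ (N ∸ L₁) (δ u₀ u) (δ v₀)) (cong (δ u₀ u *_) (sumWords-δ (N ∸ L₁) v₀))) ⟩
  sumTo N (λ L₁ → sumWords L₁ λ u → δ u₀ u * 𝕀 (length v₀ ≡ᵇ N ∸ L₁))
    ≡⟨ sumTo-cong N (λ L₁ _ → trans (sumWords-*ʳ L₁ _ (δ u₀)) (cong (_* _) (sumWords-δ L₁ u₀))) ⟩
  sumTo N (λ L₁ → 𝕀 (length u₀ ≡ᵇ L₁) * 𝕀 (length v₀ ≡ᵇ N ∸ L₁))
    ≡⟨ 𝕀-+-≡ᵇ (length u₀) (length v₀) N ⟨
  𝕀 (length u₀ ℕ.+ length v₀ ≡ᵇ N)
    ≡⟨ 𝕀-true (ℕ.≡⇒≡ᵇ _ _ len) ⟩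
  + 1 ∎
  where
  open ≡-Reasoning
  pointwise : ∀ u v → 𝕀 (isBargraph u) * (𝕀 (isBargraph v) * δ (φ u v) (φ u₀ v₀)) ≡ δ u₀ u * δ v₀ v
  pointwise u v with u₀ ≟ʷ u | v₀ ≟ʷ v
  ... | yes refl | yes refl =
    cong₂ _*_ (𝕀-true (Bargraph.isBar bgu₀)) (cong₂ _*_ (𝕀-true (Bargraph.isBar bgv₀)) (δ-refl (φ u₀ v₀)))
  ... | no u₀≢u | _ =
    𝕀-*-zero (isBargraph u) λ bgu → 𝕀-*-zero (isBargraph v) λ bgv →
      δ-≢ (λ eq → u₀≢u (sym (proj₁ (injective (bargraph bgu) (bargraph bgv) eq))))
  ... | yes refl | no v₀≢v =
    𝕀-*-zero (isBargraph u) λ bgu → 𝕀-*-zero (isBargraph v) λ bgv →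
      δ-≢ (λ eq → v₀≢v (sym (proj₂ (injective (bargraph bgu) (bargraph bgv) eq))))

decompositions : ℕ → List Step → ℤ
decompositions L w = δ unitBar w + fibre raise (L ∸ 2) w + fibre widen (L ∸ 1) w
                   + fibre ledge (L ∸ 3) w + fibre₂ graft (L ∸ 1) w

non-bargraph-decompositions : ∀ L {w} → ¬ Bargraph w → decompositions L w ≡ 0ℤ
non-bargraph-decompositions L {w} ¬bg = +-cong₅
  (δ-≢ (image {unitBar} (bargraph _)))
  (fibre-empty raise (L ∸ 2) (λ bg → image (raise-bargraph bg)))
  (fibre-empty widen (L ∸ 1) (λ bg → image (widen-bargraph bg)))
  (fibre-empty ledge (L ∸ 3) (λ bg → image (ledge-bargraph bg)))
  (fibre₂-empty graft (L ∸ 1) (λ bgu bgv → image (graft-bargraph bgu bgv)))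
  where
  image : ∀ {w′} → Bargraph w′ → w′ ≢ w
  image bg′ eq = ¬bg (subst Bargraph eq bg′)

decomposition-unique : ∀ L {w} → Decomposition w → length w ≡ L → decompositions L w ≡ + 1
decomposition-unique L unit _ = +-cong₅
  (δ-refl unitBar)
  (fibre-empty raise (L ∸ 2) λ bg → ≢-sym (ends-disjoint unitBar-ends-H (raise-ends-D bg)))
  (fibre-empty widen (L ∸ 1) widen≢unitBar)
  (fibre-empty ledge (L ∸ 3) λ bg → ≢-sym (ends-disjoint unitBar-ends-H (ledge-ends-D bg)))
  (fibre₂-empty graft (L ∸ 1) λ bgu bgv → ≢-sym (ends-disjoint unitBar-ends-H (graft-ends-D bgu bgv)))
decomposition-unique L (raised {u₀} bg₀) refl = +-cong₅
  (δ-≢ (ends-disjoint unitBar-ends-H (raise-ends-D bg₀)))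
  (fibre-single raise (L ∸ 2) (λ _ → raise-injective) bg₀ (sym (cong (_∸ 2) (length-raise u₀))))
  (fibre-empty widen (L ∸ 1) λ bg → ends-disjoint (widen-ends-H bg) (raise-ends-D bg₀))
  (fibre-empty ledge (L ∸ 3) λ _ → ≢-sym (raise≢ledge bg₀))
  (fibre₂-empty graft (L ∸ 1) λ bgu bgv → ≢-sym (raise≢graft bg₀ bgu bgv))
decomposition-unique L (widened {u₀} bg₀) refl = +-cong₅
  (δ-≢ (≢-sym (widen≢unitBar bg₀)))
  (fibre-empty raise (L ∸ 2) λ bg → ≢-sym (ends-disjoint (widen-ends-H bg₀) (raise-ends-D bg)))
  (fibre-single widen (L ∸ 1) (λ bg → widen-injective bg bg₀) bg₀ (sym (cong (_∸ 1) (length-insertLast (H ∷ []) u₀))))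
  (fibre-empty ledge (L ∸ 3) λ bg → ≢-sym (ends-disjoint (widen-ends-H bg₀) (ledge-ends-D bg)))
  (fibre₂-empty graft (L ∸ 1) λ bgu bgv → ≢-sym (ends-disjoint (widen-ends-H bg₀) (graft-ends-D bgu bgv)))
decomposition-unique L (ledged {u₀} bg₀) refl = +-cong₅
  (δ-≢ (ends-disjoint unitBar-ends-H (ledge-ends-D bg₀)))
  (fibre-empty raise (L ∸ 2) {ledge u₀} λ bg → raise≢ledge bg)
  (fibre-empty widen (L ∸ 1) λ bg → ends-disjoint (widen-ends-H bg) (ledge-ends-D bg₀))
  (fibre-single ledge (L ∸ 3) (λ _ → ledge-injective) bg₀ (sym (cong (_∸ 3) (length-raise (H ∷ u₀)))))
  (fibre₂-empty graft (L ∸ 1) λ bgu bgv → ≢-sym (ledge≢graft bg₀ bgu bgv))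
decomposition-unique L (grafted {u₀} {v₀} bgu₀ bgv₀) refl = +-cong₅
  (δ-≢ (ends-disjoint unitBar-ends-H (graft-ends-D bgu₀ bgv₀)))
  (fibre-empty raise (L ∸ 2) λ bg → raise≢graft bg bgu₀ bgv₀)
  (fibre-empty widen (L ∸ 1) λ bg → ends-disjoint (widen-ends-H bg) (graft-ends-D bgu₀ bgv₀))
  (fibre-empty ledge (L ∸ 3) λ bg → ledge≢graft bg bgu₀ bgv₀)
  (fibre₂-single graft (L ∸ 1) (λ bgu bgv → graft-injective bgu bgu₀ bgv bgv₀) bgu₀ bgv₀
    (sym (trans (cong (_∸ 1) (length-insertLast (H ∷ v₀) u₀)) (ℕ.+-comm (length v₀) (length u₀)))))

isBargraph-decompositions : ∀ L w → length w ≡ L → 𝕀 (isBargraph w) ≡ decompositions L w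
isBargraph-decompositions L w len with T? (isBargraph w)
... | yes bg = trans (𝕀-true bg) (sym (decomposition-unique L {w} (decompose (bargraph bg)) len))
... | no ¬bg = trans (𝕀-false ¬bg) (sym (non-bargraph-decompositions L {w} (¬bg ∘ Bargraph.isBar)))

+-∸-inverse : ∀ k L {x} → x ≢ 0 → x ≡ L ∸ k → k ℕ.+ x ≡ L
+-∸-inverse k L x≢0 refl = ℕ.m+[n∸m]≡n {k} (ℕ.<⇒≤ (ℕ.m∸n≢0⇒n<m x≢0))

sumWords-fibre : ∀ L k φ (f : List Step → ℤ) → (∀ u → length (φ u) ≡ k ℕ.+ length u) →
  sumWords L (λ w → fibre φ (L ∸ k) w * f w) ≡ sumWords (L ∸ k) (λ u → 𝕀 (isBargraph u) * f (φ u))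
sumWords-fibre L k φ f length-φ = begin
  sumWords L (λ w → fibre φ (L ∸ k) w * f w)
    ≡⟨ sumWords-linear L (L ∸ k) _ f ⟩
  sumWords (L ∸ k) (λ u → sumWords L λ w → 𝕀 (isBargraph u) * δ (φ u) w * f w)
    ≡⟨ sumWords-cong (L ∸ k) (λ u _ → sumWords-scale L (𝕀 (isBargraph u)) (δ (φ u)) f) ⟩
  sumWords (L ∸ k) (λ u → 𝕀 (isBargraph u) * sumWords L (λ w → δ (φ u) w * f w))
    ≡⟨ sumWords-cong (L ∸ k) (λ u len → 𝕀-*-cong (isBargraph u) λ bg →
         trans (sumWords-δ-* L (φ u) f)
               (𝕀-≡ᵇ-* (f (φ u)) (trans (length-φ u) (+-∸-inverse k L (bargraph-nonempty {u} (bargraph bg)) len)))) ⟩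
  sumWords (L ∸ k) (λ u → 𝕀 (isBargraph u) * f (φ u)) ∎
  where open ≡-Reasoning

sumWords-fibre₂ : ∀ L φ (f : List Step → ℤ) → (∀ u v → length (φ u v) ≡ suc (length v ℕ.+ length u)) →
  sumWords L (λ w → fibre₂ φ (L ∸ 1) w * f w) ≡
  sumTo (L ∸ 1) (λ L₁ → sumWords L₁ λ u → sumWords (L ∸ 1 ∸ L₁) λ v →
    𝕀 (isBargraph u) * (𝕀 (isBargraph v) * f (φ u v)))
sumWords-fibre₂ L φ f length-φ =
  trans (sumTo-linear L N _ f) (sumTo-cong N λ L₁ L₁≤N →
  trans (sumWords-linear L L₁ _ f) (sumWords-cong L₁ λ u lu →
  trans (sumWords-linear L (N ∸ L₁) _ f) (sumWords-cong (N ∸ L₁) λ v lv → begin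
    sumWords L (λ w → 𝕀 (isBargraph u) * (𝕀 (isBargraph v) * δ (φ u v) w) * f w)
      ≡⟨ sumWords-scale L (𝕀 (isBargraph u)) _ f ⟩
    𝕀 (isBargraph u) * sumWords L (λ w → 𝕀 (isBargraph v) * δ (φ u v) w * f w)
      ≡⟨ cong (𝕀 (isBargraph u) *_) (sumWords-scale L (𝕀 (isBargraph v)) (δ (φ u v)) f) ⟩
    𝕀 (isBargraph u) * (𝕀 (isBargraph v) * sumWords L (λ w → δ (φ u v) w * f w))
      ≡⟨ 𝕀-*-cong (isBargraph u) (λ bgu → cong (𝕀 (isBargraph v) *_)
           (trans (sumWords-δ-* L (φ u v) f) (𝕀-≡ᵇ-* (f (φ u v)) (fits L₁≤N lu lv (bargraph bgu))))) ⟩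
    𝕀 (isBargraph u) * (𝕀 (isBargraph v) * f (φ u v)) ∎)))
  where
  open ≡-Reasoning
  N = L ∸ 1
  fits : ∀ {L₁ u v} → L₁ ℕ.≤ N → length u ≡ L₁ → length v ≡ N ∸ L₁ → Bargraph u → length (φ u v) ≡ L
  fits {L₁} {u} {v} L₁≤N refl lv bgu = begin
    length (φ u v)                  ≡⟨ length-φ u v ⟩
    suc (length v ℕ.+ length u)     ≡⟨ cong (λ x → suc (x ℕ.+ length u)) lv ⟩
    suc (N ∸ length u ℕ.+ length u) ≡⟨ cong suc (ℕ.m∸n+n≡m L₁≤N) ⟩
    suc N                           ≡⟨ +-∸-inverse 1 L N≢0 refl ⟩
    L                               ∎
    where
    N≢0 : N ≢ 0
    N≢0 N≡0 = bargraph-nonempty bgu (ℕ.n≤0⇒n≡0 (subst (L₁ ℕ.≤_) N≡0 L₁≤N))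

-- When L < k, the sum over words of length L ∸ k = 0 sees only the empty word, which is not a bargraph.
bargraph-sum : ∀ L (f : List Step → ℤ) →
  sumWords L (λ w → 𝕀 (isBargraph w) * f w) ≡
    𝕀 (3 ≡ᵇ L) * f unitBar
  + sumWords (L ∸ 2) (λ u → 𝕀 (isBargraph u) * f (raise u))
  + sumWords (L ∸ 1) (λ u → 𝕀 (isBargraph u) * f (widen u))
  + sumWords (L ∸ 3) (λ u → 𝕀 (isBargraph u) * f (ledge u))
  + sumTo (L ∸ 1) (λ L₁ → sumWords L₁ λ u → sumWords (L ∸ 1 ∸ L₁) λ v →
      𝕀 (isBargraph u) * (𝕀 (isBargraph v) * f (graft u v)))
bargraph-sum L f = begin
  sumWords L (λ w → 𝕀 (isBargraph w) * f w)
    ≡⟨ sumWords-cong L (λ w len → trans (cong (_* f w) (isBargraph-decompositions L w len))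
         (distrib (δ unitBar w) (fibre raise (L ∸ 2) w) (fibre widen (L ∸ 1) w)
                  (fibre ledge (L ∸ 3) w) (fibre₂ graft (L ∸ 1) w) (f w))) ⟩
  sumWords L (λ w → δ unitBar w * f w + fibre raise (L ∸ 2) w * f w + fibre widen (L ∸ 1) w * f w
                  + fibre ledge (L ∸ 3) w * f w + fibre₂ graft (L ∸ 1) w * f w)
    ≡⟨ sumWords-+₅ L _ _ _ _ _ ⟩
  sumWords L (λ w → δ unitBar w * f w) + sumWords L (λ w → fibre raise (L ∸ 2) w * f w)
    + sumWords L (λ w → fibre widen (L ∸ 1) w * f w) + sumWords L (λ w → fibre ledge (L ∸ 3) w * f w)
    + sumWords L (λ w → fibre₂ graft (L ∸ 1) w * f w)
    ≡⟨ +-cong₅ (sumWords-δ-* L unitBar f)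
               (sumWords-fibre L 2 raise f length-raise)
               (sumWords-fibre L 1 widen f (length-insertLast (H ∷ [])))
               (sumWords-fibre L 3 ledge f (λ u → length-raise (H ∷ u)))
               (sumWords-fibre₂ L graft f (λ u v → length-insertLast (H ∷ v) u)) ⟩
  _ ∎
  where
  open ≡-Reasoning
  distrib : ∀ a b c d e x → (a + b + c + d + e) * x ≡ a * x + b * x + c * x + d * x + e * x
  distrib = solve-∀

mono≡𝕀 : ∀ a b c i j l → mono a b c i j l ≡ 𝕀 ((a , b , c) ≡ᵇ³ (i , j , l))
mono≡𝕀 a b c i j l with (a ≡ᵇ i) ∧ (b ≡ᵇ j) ∧ (c ≡ᵇ l)
... | true  = refl
... | false = refl

mono-⊛ : ∀ a b c f k n m →
  (mono a b c ⊛ f) k n m ≡ 𝕀 ((a , b , c) ≤ᵇ³ (k , n , m)) * f (k ∸ a) (n ∸ b) (m ∸ c)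
mono-⊛ a b c f k n m = begin
  sum³ k n m (λ i j l → mono a b c i j l * f (k ∸ i) (n ∸ j) (m ∸ l))
    ≡⟨ sum³-cong k n m (λ i j l _ _ _ →
         trans (cong (_* _) (trans (mono≡𝕀 a b c i j l) (𝕀-∧³ (a ≡ᵇ i) (b ≡ᵇ j) (c ≡ᵇ l))))
               (assoc³ (𝕀 (a ≡ᵇ i)) (𝕀 (b ≡ᵇ j)) (𝕀 (c ≡ᵇ l)) (f (k ∸ i) (n ∸ j) (m ∸ l)))) ⟩
  sum³ k n m (λ i j l → 𝕀 (a ≡ᵇ i) * (𝕀 (b ≡ᵇ j) * (𝕀 (c ≡ᵇ l) * f (k ∸ i) (n ∸ j) (m ∸ l))))
    ≡⟨ sumTo-cong k (λ i _ → sumTo-cong n λ j _ →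
         trans (sumTo-*ˡ m (𝕀 (a ≡ᵇ i)) _) (cong (𝕀 (a ≡ᵇ i) *_)
        (trans (sumTo-*ˡ m (𝕀 (b ≡ᵇ j)) _) (cong (𝕀 (b ≡ᵇ j) *_) (sumTo-indicator c m _))))) ⟩
  sumTo k (λ i → sumTo n λ j → 𝕀 (a ≡ᵇ i) * (𝕀 (b ≡ᵇ j) * (𝕀 (c ≤ᵇ m) * f (k ∸ i) (n ∸ j) (m ∸ c))))
    ≡⟨ sumTo-cong k (λ i _ → trans (sumTo-*ˡ n (𝕀 (a ≡ᵇ i)) _) (cong (𝕀 (a ≡ᵇ i) *_) (sumTo-indicator b n _))) ⟩
  sumTo k (λ i → 𝕀 (a ≡ᵇ i) * (𝕀 (b ≤ᵇ n) * (𝕀 (c ≤ᵇ m) * f (k ∸ i) (n ∸ b) (m ∸ c))))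
    ≡⟨ sumTo-indicator a k _ ⟩
  𝕀 (a ≤ᵇ k) * (𝕀 (b ≤ᵇ n) * (𝕀 (c ≤ᵇ m) * f (k ∸ a) (n ∸ b) (m ∸ c)))
    ≡⟨ assoc³ (𝕀 (a ≤ᵇ k)) (𝕀 (b ≤ᵇ n)) (𝕀 (c ≤ᵇ m)) (f (k ∸ a) (n ∸ b) (m ∸ c)) ⟨
  𝕀 (a ≤ᵇ k) * (𝕀 (b ≤ᵇ n) * 𝕀 (c ≤ᵇ m)) * f (k ∸ a) (n ∸ b) (m ∸ c)
    ≡⟨ cong (_* f (k ∸ a) (n ∸ b) (m ∸ c)) (𝕀-∧³ (a ≤ᵇ k) (b ≤ᵇ n) (c ≤ᵇ m)) ⟨
  𝕀 ((a , b , c) ≤ᵇ³ (k , n , m)) * f (k ∸ a) (n ∸ b) (m ∸ c) ∎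
  where
  open ≡-Reasoning
  assoc³ : ∀ p q r x → p * (q * r) * x ≡ p * (q * (r * x))
  assoc³ = solve-∀

⊛-congˡ : ∀ {f g} h → (∀ i j l → f i j l ≡ g i j l) → ∀ k n m → (f ⊛ h) k n m ≡ (g ⊛ h) k n m
⊛-congˡ h f≗g k n m = sum³-cong k n m (λ i j l _ _ _ → cong (_* h (k ∸ i) (n ∸ j) (m ∸ l)) (f≗g i j l))

mono-⊛-mono : ∀ a b c a′ b′ c′ k n m →
  (mono a b c ⊛ mono a′ b′ c′) k n m ≡ mono (a ℕ.+ a′) (b ℕ.+ b′) (c ℕ.+ c′) k n m
mono-⊛-mono a b c a′ b′ c′ k n m = begin
  (mono a b c ⊛ mono a′ b′ c′) k n m
    ≡⟨ mono-⊛ a b c (mono a′ b′ c′) k n m ⟩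
  𝕀 ((a , b , c) ≤ᵇ³ (k , n , m)) * mono a′ b′ c′ (k ∸ a) (n ∸ b) (m ∸ c)
    ≡⟨ cong (𝕀 ((a , b , c) ≤ᵇ³ (k , n , m)) *_) (mono≡𝕀 a′ b′ c′ (k ∸ a) (n ∸ b) (m ∸ c)) ⟩
  𝕀 ((a , b , c) ≤ᵇ³ (k , n , m)) * 𝕀 ((a′ , b′ , c′) ≡ᵇ³ (k ∸ a , n ∸ b , m ∸ c))
    ≡⟨ 𝕀-+³-≡ᵇ³ (a , b , c) (a′ , b′ , c′) (k , n , m) ⟨
  𝕀 ((a ℕ.+ a′ , b ℕ.+ b′ , c ℕ.+ c′) ≡ᵇ³ (k , n , m))
    ≡⟨ mono≡𝕀 (a ℕ.+ a′) (b ℕ.+ b′) (c ℕ.+ c′) k n m ⟨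
  mono (a ℕ.+ a′) (b ℕ.+ b′) (c ℕ.+ c′) k n m ∎
  where open ≡-Reasoning

𝟙-⊛ : ∀ f k n m → (𝟙 ⊛ f) k n m ≡ f k n m
𝟙-⊛ f k n m = trans (mono-⊛ 0 0 0 f k n m) (ℤ.*-identityˡ (f k n m))

⊖-⊛ : ∀ f g h k n m → ((f ⊖ g) ⊛ h) k n m ≡ (f ⊛ h) k n m - (g ⊛ h) k n m
⊖-⊛ f g h k n m =
  trans (sum³-cong k n m (λ i j l _ _ _ → distrib (f i j l) (g i j l) (h (k ∸ i) (n ∸ j) (m ∸ l))))
  (trans (sumTo-cong k (λ i _ → trans (sumTo-cong n λ j _ → sumTo-- m _ _) (sumTo-- n _ _)))
         (sumTo-- k _ _))
  where
  distrib : ∀ a b c → (a - b) * c ≡ a * c - b * c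
  distrib = solve-∀

𝕩-⊛-⊛ : ∀ f g k n m → ((𝕩 ⊛ f) ⊛ g) k n m ≡ (𝕩 ⊛ (f ⊛ g)) k n m
𝕩-⊛-⊛ f g k n m =
  trans (⊛-congˡ g (mono-⊛ 0 1 0 f) k n m) (trans (shifted n) (sym (mono-⊛ 0 1 0 (f ⊛ g) k n m)))
  where
  open ≡-Reasoning
  x·f : ℕ → ℕ → ℕ → ℤ
  x·f i j l = 𝕀 ((0 , 1 , 0) ≤ᵇ³ (i , j , l)) * f i (j ∸ 1) l
  shifted : ∀ n → (x·f ⊛ g) k n m ≡ 𝕀 ((0 , 1 , 0) ≤ᵇ³ (k , n , m)) * (f ⊛ g) k (n ∸ 1) m
  rest : ℕ → ℕ → ℤ
  rest n i = sumTo n λ j → sumTo m λ l → + 1 * f i j l * g (k ∸ i) (n ∸ j) (m ∸ l)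
  shifted zero    = trans (sumTo-cong k (λ i _ → sumTo-zero m)) (sumTo-zero k)
  shifted (suc n) = begin
    (x·f ⊛ g) k (suc n) m
      ≡⟨ sumTo-cong k (λ i _ → sumTo-suc n _) ⟩
    sumTo k (λ i → sumTo m (λ _ → 0ℤ) + sumTo n λ j → sumTo m λ l → + 1 * f i j l * g (k ∸ i) (n ∸ j) (m ∸ l))
      ≡⟨ sumTo-cong k (λ i _ → trans (cong (_+ rest n i) (sumTo-zero m)) (trans (ℤ.+-identityˡ (rest n i))
           (sumTo-cong n λ j _ → sumTo-cong m λ l _ → cong (_* g (k ∸ i) (n ∸ j) (m ∸ l)) (ℤ.*-identityˡ (f i j l))))) ⟩
    (f ⊛ g) k n m
      ≡⟨ ℤ.*-identityˡ ((f ⊛ g) k n m) ⟨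
    + 1 * (f ⊛ g) k n m ∎

𝕥⊛𝕩⊛𝕪 : ∀ k n m → (𝕥 ⊛ 𝕩 ⊛ 𝕪) k n m ≡ mono 1 1 1 k n m
𝕥⊛𝕩⊛𝕪 k n m = trans (⊛-congˡ 𝕪 (mono-⊛-mono 1 0 0 0 1 0) k n m) (mono-⊛-mono 1 1 0 0 0 1 k n m)

-- Counting bargraphs by statistics

weight : ℕ × ℕ × ℕ → List Step → ℤ
weight s u = 𝕀 (isBargraph u) * 𝕀 (stats u ≡ᵇ³ s)

Q-as-sum : ∀ k n m → Q k n m ≡ sumWords (n ℕ.+ (m ℕ.+ m)) (weight (k , n , m))
Q-as-sum k n m = trans (length-filterᵇ _ (allWords L)) (trans (sumList-allWords L _)
                   (sumWords-cong L (λ w _ → 𝕀-∧ (isBargraph w) (stats w ≡ᵇ³ (k , n , m)))))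
  where L = n ℕ.+ (m ℕ.+ m)

count-at-length : ∀ L i j l →
  sumWords L (weight (i , j , l)) ≡ 𝕀 (j ℕ.+ (l ℕ.+ l) ≡ᵇ L) * Q i j l
count-at-length L i j l with j ℕ.+ (l ℕ.+ l) ℕ.≟ L
... | yes refl = trans (sym (Q-as-sum i j l)) (sym (𝕀-≡ᵇ-* {j ℕ.+ (l ℕ.+ l)} (Q i j l) refl))
... | no len≢ = trans (sumWords-cong L (λ u len → 𝕀-*-zero (isBargraph u) λ bg → 𝕀-false λ st →
                         len≢ (trans (sym (length-at {u} (bargraph bg) (≡ᵇ³⇒≡ (stats u) _ st))) len)))
                (trans (sumWords-zero L) (sym (cong (_* Q i j l) (𝕀-false (len≢ ∘ ℕ.≡ᵇ⇒≡ _ _)))))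
  where
  length-at : ∀ {u} → Bargraph u → stats u ≡ (i , j , l) → length u ≡ j ℕ.+ (l ℕ.+ l)
  length-at bg refl = bargraph-length bg

∸-length : ∀ {b c n m} → b ℕ.≤ n → c ℕ.≤ m →
           n ∸ b ℕ.+ (m ∸ c ℕ.+ (m ∸ c)) ≡ n ℕ.+ (m ℕ.+ m) ∸ (b ℕ.+ (c ℕ.+ c))
∸-length {b} {c} {n} {m} b≤n c≤m = begin
  n ∸ b ℕ.+ (m ∸ c ℕ.+ (m ∸ c))
    ≡⟨ ℕ.m+n∸n≡m _ (b ℕ.+ (c ℕ.+ c)) ⟨
  n ∸ b ℕ.+ (m ∸ c ℕ.+ (m ∸ c)) ℕ.+ (b ℕ.+ (c ℕ.+ c)) ∸ (b ℕ.+ (c ℕ.+ c))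
    ≡⟨ cong (_∸ (b ℕ.+ (c ℕ.+ c))) (regroup (n ∸ b) (m ∸ c) b c) ⟩
  (n ∸ b ℕ.+ b) ℕ.+ ((m ∸ c ℕ.+ c) ℕ.+ (m ∸ c ℕ.+ c)) ∸ (b ℕ.+ (c ℕ.+ c))
    ≡⟨ cong₂ (λ x y → x ℕ.+ (y ℕ.+ y) ∸ (b ℕ.+ (c ℕ.+ c))) (ℕ.m∸n+n≡m b≤n) (ℕ.m∸n+n≡m c≤m) ⟩
  n ℕ.+ (m ℕ.+ m) ∸ (b ℕ.+ (c ℕ.+ c)) ∎
  where
  open ≡-Reasoning
  regroup : ∀ x y b c → x ℕ.+ (y ℕ.+ y) ℕ.+ (b ℕ.+ (c ℕ.+ c)) ≡ (x ℕ.+ b) ℕ.+ ((y ℕ.+ c) ℕ.+ (y ℕ.+ c))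
  regroup = ℕ-Solver.solve-∀

split-length : ∀ {j l n m} → j ℕ.≤ n → l ℕ.≤ m →
  j ℕ.+ (l ℕ.+ l) ℕ.+ (n ∸ j ℕ.+ (m ∸ l ℕ.+ (m ∸ l))) ≡ n ℕ.+ (m ℕ.+ m)
split-length {j} {l} {n} {m} j≤n l≤m =
  trans (cong (j ℕ.+ (l ℕ.+ l) ℕ.+_) (∸-length j≤n l≤m))
        (ℕ.m+[n∸m]≡n (ℕ.+-mono-≤ j≤n (ℕ.+-mono-≤ l≤m l≤m)))

shifted-count : ∀ (φ : List Step → List Step) a b c →
  (∀ {u} → Bargraph u → stats (φ u) ≡ (a , b , c) +³ stats u) → ∀ k n m →
  sumWords (n ℕ.+ (m ℕ.+ m) ∸ (b ℕ.+ (c ℕ.+ c))) (λ u → 𝕀 (isBargraph u) * 𝕀 (stats (φ u) ≡ᵇ³ (k , n , m)))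
    ≡ (mono a b c ⊛ Q) k n m
shifted-count φ a b c φ-stats k n m = begin
  sumWords L′ (λ u → 𝕀 (isBargraph u) * 𝕀 (stats (φ u) ≡ᵇ³ (k , n , m)))
    ≡⟨ sumWords-cong L′ (λ u _ → 𝕀-*-cong (isBargraph u) λ bg →
         trans (cong (λ s → 𝕀 (s ≡ᵇ³ (k , n , m))) (φ-stats {u} (bargraph bg)))
               (𝕀-+³-≡ᵇ³ (a , b , c) (stats u) (k , n , m))) ⟩
  sumWords L′ (λ u → 𝕀 (isBargraph u) * (𝕀 fits * 𝕀 (stats u ≡ᵇ³ K′)))
    ≡⟨ sumWords-cong L′ (λ u _ → swap (𝕀 (isBargraph u)) (𝕀 fits) (𝕀 (stats u ≡ᵇ³ K′))) ⟩
  sumWords L′ (λ u → 𝕀 fits * (𝕀 (isBargraph u) * 𝕀 (stats u ≡ᵇ³ K′)))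
    ≡⟨ sumWords-*ˡ L′ (𝕀 fits) _ ⟩
  𝕀 fits * sumWords L′ (weight K′)
    ≡⟨ cong (𝕀 fits *_) (count-at-length L′ (k ∸ a) (n ∸ b) (m ∸ c)) ⟩
  𝕀 fits * (𝕀 (n ∸ b ℕ.+ (m ∸ c ℕ.+ (m ∸ c)) ≡ᵇ L′) * Q (k ∸ a) (n ∸ b) (m ∸ c))
    ≡⟨ 𝕀-*-cong fits (λ le → let _ , b≤n , c≤m = ≤ᵇ³⇒≤ a b c k n m le in
                               𝕀-≡ᵇ-* (Q (k ∸ a) (n ∸ b) (m ∸ c)) (∸-length b≤n c≤m)) ⟩
  𝕀 fits * Q (k ∸ a) (n ∸ b) (m ∸ c)
    ≡⟨ mono-⊛ a b c Q k n m ⟨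
  (mono a b c ⊛ Q) k n m ∎
  where
  open ≡-Reasoning
  L′ : ℕ
  L′ = n ℕ.+ (m ℕ.+ m) ∸ (b ℕ.+ (c ℕ.+ c))
  K′ : ℕ × ℕ × ℕ
  K′ = (k , n , m) ∸³ (a , b , c)
  fits : Bool
  fits = (a , b , c) ≤ᵇ³ (k , n , m)
  swap : ∀ x y z → x * (y * z) ≡ y * (x * z)
  swap = solve-∀

unit-count : ∀ k n m → 𝕀 (3 ≡ᵇ n ℕ.+ (m ℕ.+ m)) * 𝕀 (stats unitBar ≡ᵇ³ (k , n , m)) ≡ (𝕩 ⊛ 𝕪) k n m
unit-count k n m = trans (length-forced k n m) (sym (trans (mono-⊛-mono 0 1 0 0 0 1 k n m) (mono≡𝕀 0 1 1 k n m)))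
  where
  length-forced : ∀ k n m → 𝕀 (3 ≡ᵇ n ℕ.+ (m ℕ.+ m)) * 𝕀 ((0 , 1 , 1) ≡ᵇ³ (k , n , m)) ≡ 𝕀 ((0 , 1 , 1) ≡ᵇ³ (k , n , m))
  length-forced k n m with T? ((0 , 1 , 1) ≡ᵇ³ (k , n , m))
  ... | yes eq with refl ← ≡ᵇ³⇒≡ (0 , 1 , 1) (k , n , m) eq = refl
  ... | no ¬eq rewrite 𝕀-false ¬eq = ℤ.*-zeroʳ (𝕀 (3 ≡ᵇ n ℕ.+ (m ℕ.+ m)))

graft-weight : ∀ k n m u v →
  𝕀 (isBargraph u) * (𝕀 (isBargraph v) * 𝕀 (stats (graft u v) ≡ᵇ³ (k , n , m))) ≡
  𝕀 ((0 , 1 , 0) ≤ᵇ³ (k , n , m)) *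
    sum³ k (n ∸ 1) m (λ i j l → weight (i , j , l) u * weight (k ∸ i , n ∸ 1 ∸ j , m ∸ l) v)
graft-weight k n m u v = begin
  𝕀 (isBargraph u) * (𝕀 (isBargraph v) * 𝕀 (stats (graft u v) ≡ᵇ³ (k , n , m)))
    ≡⟨ 𝕀-*-cong (isBargraph u) (λ bg → cong (𝕀 (isBargraph v) *_) (begin
         𝕀 (stats (graft u v) ≡ᵇ³ (k , n , m))
           ≡⟨ cong (λ s → 𝕀 (s ≡ᵇ³ (k , n , m))) (graft-stats {u} v (bargraph bg)) ⟩
         𝕀 ((0 , 1 , 0) +³ (stats u +³ stats v) ≡ᵇ³ (k , n , m))
           ≡⟨ 𝕀-+³-≡ᵇ³ (0 , 1 , 0) (stats u +³ stats v) (k , n , m) ⟩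
         𝕀 fits * 𝕀 (stats u +³ stats v ≡ᵇ³ (k , n ∸ 1 , m))
           ≡⟨ cong (𝕀 fits *_) (𝕀-+³-split (stats u) (stats v) k (n ∸ 1) m) ⟩
         𝕀 fits * S ∎)) ⟩
  𝕀 (isBargraph u) * (𝕀 (isBargraph v) * (𝕀 fits * S))
    ≡⟨ swap (𝕀 (isBargraph u)) (𝕀 (isBargraph v)) (𝕀 fits) S ⟩
  𝕀 fits * (𝕀 (isBargraph u) * (𝕀 (isBargraph v) * S))
    ≡⟨ cong (𝕀 fits *_) (trans (cong (𝕀 (isBargraph u) *_) (sym (sum³-*ˡ k (n ∸ 1) m (𝕀 (isBargraph v)) _)))
                               (sym (sum³-*ˡ k (n ∸ 1) m (𝕀 (isBargraph u)) _))) ⟩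
  𝕀 fits * sum³ k (n ∸ 1) m (λ i j l → 𝕀 (isBargraph u) * (𝕀 (isBargraph v) *
              (𝕀 (stats u ≡ᵇ³ (i , j , l)) * 𝕀 (stats v ≡ᵇ³ (k ∸ i , n ∸ 1 ∸ j , m ∸ l)))))
    ≡⟨ cong (𝕀 fits *_) (sum³-cong k (n ∸ 1) m λ i j l _ _ _ → interleave (𝕀 (isBargraph u)) (𝕀 (isBargraph v)) _ _) ⟩
  𝕀 fits * sum³ k (n ∸ 1) m (λ i j l → weight (i , j , l) u * weight (k ∸ i , n ∸ 1 ∸ j , m ∸ l) v) ∎
  where
  open ≡-Reasoning
  fits : Bool
  fits = (0 , 1 , 0) ≤ᵇ³ (k , n , m)
  S : ℤ
  S = sum³ k (n ∸ 1) m (λ i j l → 𝕀 (stats u ≡ᵇ³ (i , j , l)) * 𝕀 (stats v ≡ᵇ³ (k ∸ i , n ∸ 1 ∸ j , m ∸ l)))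
  swap : ∀ x y z s → x * (y * (z * s)) ≡ z * (x * (y * s))
  swap = solve-∀
  interleave : ∀ x y p q → x * (y * (p * q)) ≡ x * p * (y * q)
  interleave = solve-∀

sumWords²-sum³ : ∀ N k n m c (F G : ℕ → ℕ → ℕ → List Step → ℤ) →
  sumTo N (λ L₁ → sumWords L₁ λ u → sumWords (N ∸ L₁) λ v → c * sum³ k n m (λ i j l → F i j l u * G i j l v)) ≡
  c * sum³ k n m (λ i j l → sumTo N (λ L₁ → sumWords L₁ (F i j l) * sumWords (N ∸ L₁) (G i j l)))
sumWords²-sum³ N k n m c F G = begin
  sumTo N (λ L₁ → sumWords L₁ λ u → sumWords (N ∸ L₁) λ v → c * sum³ k n m (λ i j l → F i j l u * G i j l v))
    ≡⟨ sumTo-cong N (λ L₁ _ → sumWords-cong L₁ λ u _ →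
         trans (sumWords-*ˡ (N ∸ L₁) c _) (cong (c *_) (trans (sumWords-sum³ (N ∸ L₁) k n m _)
           (sum³-cong k n m λ i j l _ _ _ → sumWords-*ˡ (N ∸ L₁) (F i j l u) (G i j l))))) ⟩
  sumTo N (λ L₁ → sumWords L₁ λ u → c * sum³ k n m (λ i j l → F i j l u * sumWords (N ∸ L₁) (G i j l)))
    ≡⟨ sumTo-cong N (λ L₁ _ →
         trans (sumWords-*ˡ L₁ c _) (cong (c *_) (trans (sumWords-sum³ L₁ k n m _)
           (sum³-cong k n m λ i j l _ _ _ → sumWords-*ʳ L₁ (sumWords (N ∸ L₁) (G i j l)) (F i j l))))) ⟩
  sumTo N (λ L₁ → c * sum³ k n m (λ i j l → sumWords L₁ (F i j l) * sumWords (N ∸ L₁) (G i j l)))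
    ≡⟨ trans (sumTo-*ˡ N c _) (cong (c *_) (sumTo-sum³ N k n m _)) ⟩
  c * sum³ k n m (λ i j l → sumTo N (λ L₁ → sumWords L₁ (F i j l) * sumWords (N ∸ L₁) (G i j l))) ∎
  where open ≡-Reasoning

convolution-count : ∀ N i j l i′ j′ l′ → j ℕ.+ (l ℕ.+ l) ℕ.+ (j′ ℕ.+ (l′ ℕ.+ l′)) ≡ N →
  sumTo N (λ L₁ → sumWords L₁ (weight (i , j , l)) * sumWords (N ∸ L₁) (weight (i′ , j′ , l′))) ≡ Q i j l * Q i′ j′ l′
convolution-count N i j l i′ j′ l′ len = begin
  sumTo N (λ L₁ → sumWords L₁ (weight (i , j , l)) * sumWords (N ∸ L₁) (weight (i′ , j′ , l′)))
    ≡⟨ sumTo-cong N (λ L₁ _ → trans (cong₂ _*_ (count-at-length L₁ i j l) (count-at-length (N ∸ L₁) i′ j′ l′))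
                                    (regroup (𝕀 (a ≡ᵇ L₁)) (Q i j l) (𝕀 (b ≡ᵇ N ∸ L₁)) (Q i′ j′ l′))) ⟩
  sumTo N (λ L₁ → 𝕀 (a ≡ᵇ L₁) * (𝕀 (b ≡ᵇ N ∸ L₁) * (Q i j l * Q i′ j′ l′)))
    ≡⟨ sumTo-indicator a N _ ⟩
  𝕀 (a ≤ᵇ N) * (𝕀 (b ≡ᵇ N ∸ a) * (Q i j l * Q i′ j′ l′))
    ≡⟨ ℤ.*-assoc (𝕀 (a ≤ᵇ N)) _ _ ⟨
  𝕀 (a ≤ᵇ N) * 𝕀 (b ≡ᵇ N ∸ a) * (Q i j l * Q i′ j′ l′)
    ≡⟨ cong (_* (Q i j l * Q i′ j′ l′)) (trans (sym (𝕀-∧ (a ≤ᵇ N) _)) (cong 𝕀 (sym (+-≡ᵇ a b N)))) ⟩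
  𝕀 (a ℕ.+ b ≡ᵇ N) * (Q i j l * Q i′ j′ l′)
    ≡⟨ 𝕀-≡ᵇ-* (Q i j l * Q i′ j′ l′) len ⟩
  Q i j l * Q i′ j′ l′ ∎
  where
  open ≡-Reasoning
  a = j ℕ.+ (l ℕ.+ l)
  b = j′ ℕ.+ (l′ ℕ.+ l′)
  regroup : ∀ p x q y → p * x * (q * y) ≡ p * (q * (x * y))
  regroup = solve-∀

graft-count : ∀ k n m →
  sumTo (n ℕ.+ (m ℕ.+ m) ∸ 1) (λ L₁ → sumWords L₁ λ u → sumWords (n ℕ.+ (m ℕ.+ m) ∸ 1 ∸ L₁) λ v →
    𝕀 (isBargraph u) * (𝕀 (isBargraph v) * 𝕀 (stats (graft u v) ≡ᵇ³ (k , n , m))))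
  ≡ (𝕩 ⊛ Q ⊛ Q) k n m
graft-count k n m = begin
  sumTo N (λ L₁ → sumWords L₁ λ u → sumWords (N ∸ L₁) λ v →
    𝕀 (isBargraph u) * (𝕀 (isBargraph v) * 𝕀 (stats (graft u v) ≡ᵇ³ (k , n , m))))
    ≡⟨ sumTo-cong N (λ L₁ _ → sumWords-cong L₁ λ u _ → sumWords-cong (N ∸ L₁) λ v _ → graft-weight k n m u v) ⟩
  sumTo N (λ L₁ → sumWords L₁ λ u → sumWords (N ∸ L₁) λ v →
    𝕀 fits * sum³ k (n ∸ 1) m (λ i j l → weight (i , j , l) u * weight (k ∸ i , n ∸ 1 ∸ j , m ∸ l) v))
    ≡⟨ sumWords²-sum³ N k (n ∸ 1) m (𝕀 fits) _ _ ⟩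
  𝕀 fits * sum³ k (n ∸ 1) m (λ i j l →
    sumTo N (λ L₁ → sumWords L₁ (weight (i , j , l)) * sumWords (N ∸ L₁) (weight (k ∸ i , n ∸ 1 ∸ j , m ∸ l))))
    ≡⟨ 𝕀-*-cong fits (λ le → sum³-cong k (n ∸ 1) m λ i j l _ j≤n′ l≤m →
         convolution-count N i j l (k ∸ i) (n ∸ 1 ∸ j) (m ∸ l)
           (trans (split-length j≤n′ l≤m) (sym (ℕ.+-∸-comm (m ℕ.+ m) (proj₁ (proj₂ (≤ᵇ³⇒≤ 0 1 0 k n m le))))))) ⟩
  𝕀 fits * (Q ⊛ Q) k (n ∸ 1) m
    ≡⟨ mono-⊛ 0 1 0 (Q ⊛ Q) k n m ⟨
  (𝕩 ⊛ (Q ⊛ Q)) k n m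
    ≡⟨ 𝕩-⊛-⊛ Q Q k n m ⟨
  (𝕩 ⊛ Q ⊛ Q) k n m ∎
  where
  open ≡-Reasoning
  N : ℕ
  N = n ℕ.+ (m ℕ.+ m) ∸ 1
  fits : Bool
  fits = (0 , 1 , 0) ≤ᵇ³ (k , n , m)

Q-equation : ∀ k n m → Q k n m ≡ (𝕩 ⊛ 𝕪 ⊕ 𝕪 ⊛ Q ⊕ 𝕩 ⊛ Q ⊕ 𝕥 ⊛ 𝕩 ⊛ 𝕪 ⊛ Q ⊕ 𝕩 ⊛ Q ⊛ Q) k n m
Q-equation k n m = begin
  Q k n m
    ≡⟨ Q-as-sum k n m ⟩
  sumWords (n ℕ.+ (m ℕ.+ m)) (weight (k , n , m))
    ≡⟨ bargraph-sum (n ℕ.+ (m ℕ.+ m)) (λ w → 𝕀 (stats w ≡ᵇ³ (k , n , m))) ⟩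
  _
    ≡⟨ +-cong₅ (unit-count k n m)
               (shifted-count raise 0 0 1 raise-stats k n m)
               (shifted-count widen 0 1 0 widen-stats k n m)
               (trans (shifted-count ledge 1 1 1 ledge-stats k n m) (sym (⊛-congˡ Q 𝕥⊛𝕩⊛𝕪 k n m)))
               (graft-count k n m) ⟩
  (𝕩 ⊛ 𝕪 ⊕ 𝕪 ⊛ Q ⊕ 𝕩 ⊛ Q ⊕ 𝕥 ⊛ 𝕩 ⊛ 𝕪 ⊛ Q ⊕ 𝕩 ⊛ Q ⊛ Q) k n m ∎
  where open ≡-Reasoning

mainTheorem17 : (k n m : ℕ) →
    (𝕩 ⊛ Q ⊛ Q ⊖ (𝟙 ⊖ 𝕩 ⊖ 𝕪 ⊖ 𝕥 ⊛ 𝕩 ⊛ 𝕪) ⊛ Q ⊕ 𝕩 ⊛ 𝕪) k n m ≡ 0ℤ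
mainTheorem17 k n m = begin
  (𝕩 ⊛ Q ⊛ Q) k n m - ((𝟙 ⊖ 𝕩 ⊖ 𝕪 ⊖ 𝕥 ⊛ 𝕩 ⊛ 𝕪) ⊛ Q) k n m + (𝕩 ⊛ 𝕪) k n m
    ≡⟨ cong (λ z → (𝕩 ⊛ Q ⊛ Q) k n m - z + (𝕩 ⊛ 𝕪) k n m) expand ⟩
  (𝕩 ⊛ Q ⊛ Q) k n m - (Q k n m - (𝕩 ⊛ Q) k n m - (𝕪 ⊛ Q) k n m - (𝕥 ⊛ 𝕩 ⊛ 𝕪 ⊛ Q) k n m) + (𝕩 ⊛ 𝕪) k n m
    ≡⟨ cong (λ z → (𝕩 ⊛ Q ⊛ Q) k n m - (z - (𝕩 ⊛ Q) k n m - (𝕪 ⊛ Q) k n m - (𝕥 ⊛ 𝕩 ⊛ 𝕪 ⊛ Q) k n m) + (𝕩 ⊛ 𝕪) k n m)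
            (Q-equation k n m) ⟩
  _
    ≡⟨ cancel ((𝕩 ⊛ 𝕪) k n m) ((𝕪 ⊛ Q) k n m) ((𝕩 ⊛ Q) k n m) ((𝕥 ⊛ 𝕩 ⊛ 𝕪 ⊛ Q) k n m) ((𝕩 ⊛ Q ⊛ Q) k n m) ⟩
  0ℤ ∎
  where
  open ≡-Reasoning
  expand : ((𝟙 ⊖ 𝕩 ⊖ 𝕪 ⊖ 𝕥 ⊛ 𝕩 ⊛ 𝕪) ⊛ Q) k n m ≡ Q k n m - (𝕩 ⊛ Q) k n m - (𝕪 ⊛ Q) k n m - (𝕥 ⊛ 𝕩 ⊛ 𝕪 ⊛ Q) k n m
  expand =
    trans (⊖-⊛ (𝟙 ⊖ 𝕩 ⊖ 𝕪) (𝕥 ⊛ 𝕩 ⊛ 𝕪) Q k n m) (cong (_- (𝕥 ⊛ 𝕩 ⊛ 𝕪 ⊛ Q) k n m)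
    (trans (⊖-⊛ (𝟙 ⊖ 𝕩) 𝕪 Q k n m) (cong (_- (𝕪 ⊛ Q) k n m)
    (trans (⊖-⊛ 𝟙 𝕩 Q k n m) (cong (_- (𝕩 ⊛ Q) k n m) (𝟙-⊛ Q k n m))))))
  cancel : ∀ xy yq xq txyq xqq → xqq - (xy + yq + xq + txyq + xqq - xq - yq - txyq) + xy ≡ 0ℤ
  cancel = solve-∀
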